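{- Let $r\ge2$ be fixed and let $\{K_{s,i},K^{\mathrm{dbl}}_{s,i}\}$ be defined by $K_{1,i}=K^{\mathrm{dbl}}_{1,i}=1$; $K_{2,i}=2$; $K_{s,1}=2K_{s-1,1}=2^{s-1}$; $K_{s,i}=2K_{s-1,i}+K_{s-2,i}(K_{s,i-1}-2)$; $K^{\mathrm{dbl}}_{2,i}=2\cdot6^{r-1}$; $K^{\mathrm{dbl}}_{s,1}=2K^{\mathrm{dbl}}_{s-1,1}+1$; $K^{\mathrm{dbl}}_{s,i}=K^{\mathrm{dbl}}_{s,i-1}+2K^{\mathrm{dbl}}_{s-1,i}+(K^{\mathrm{dbl}}_{s-2,i}+2)K_{s,i-1}$ (recursions for $s\ge3$, $i\ge2$). With $t=\lfloor(s-2)/2\rfloor$, for $i\ge1$: $K_{3,i}=2i+2$; $K^{\mathrm{dbl}}_{3,i}=\Theta(i^2)$; $K_{4,i},K^{\mathrm{dbl}}_{4,i}=\Theta(2^i)$; $K_{5,i},K^{\mathrm{dbl}}_{5,i}\le 2^i(i+O(1))!$; $K_{s,i},K^{\mathrm{dbl}}_{s,i}\le 2^{\binom{i+O(1)}{t}}$ for even $s>4$; $K_{s,i},K^{\mathrm{dbl}}_{s,i}\le 2^{\binom{i+O(1)}{t}\log(2(i+1)/e)}$ for odd $s>5$.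
   Context: Asymptotic notation is as $i\to\infty$ with $r$ and $s$ fixed; hidden constants may depend on $r$ and $s$. $\log$ is base 2. -}

module Defs where

open import Data.Nat.Base
open import Data.Product using (∃-syntax; _×_)

-- K s i  (paper: K_{s,i}), meaningful for s ≥ 1, i ≥ 1; junk value 0 otherwise.
-- For s ≥ 2 one has K s i ≥ 2, so the truncated subtraction (K s (i-1) ∸ 2)
-- in the recursion agrees with the integer subtraction of the paper.
K : ℕ → ℕ → ℕ
K zero _ = 0
K (suc _) zero = 0
K 1 (suc i) = 1
K 2 (suc i) = 2
K (suc (suc (suc s))) 1 = 2 * K (suc (suc s)) 1
K (suc (suc (suc s))) (suc (suc i)) =
  2 * K (suc (suc s)) (suc (suc i))
    + K (suc s) (suc (suc i)) * (K (suc (suc (suc s))) (suc i) ∸ 2)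

-- Kdbl r s i  (paper: K^dbl_{s,i}, which depends on the fixed r ≥ 2);
-- meaningful for s ≥ 1, i ≥ 1; junk value 0 otherwise.
Kdbl : ℕ → ℕ → ℕ → ℕ
Kdbl r zero _ = 0
Kdbl r (suc _) zero = 0
Kdbl r 1 (suc i) = 1
Kdbl r 2 (suc i) = 2 * 6 ^ (r ∸ 1)
Kdbl r (suc (suc (suc s))) 1 = 2 * Kdbl r (suc (suc s)) 1 + 1
Kdbl r (suc (suc (suc s))) (suc (suc i)) =
  Kdbl r (suc (suc (suc s))) (suc i)
    + 2 * Kdbl r (suc (suc s)) (suc (suc i))
    + (Kdbl r (suc s) (suc (suc i)) + 2) * K (suc (suc (suc s))) (suc i)

Eventually : (ℕ → Set) → Set
Eventually P = ∃[ N ] (∀ i → N ≤ i → P i)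

-- f = Θ(g) as i → ∞ (constants A, B ∈ ℕ; g ≤ A f is the lower bound f ≥ g/A)
IsΘ : (ℕ → ℕ) → (ℕ → ℕ) → Set
IsΘ f g = ∃[ A ] ∃[ B ] Eventually (λ i → g i ≤ A * f i × f i ≤ B * g i)

-- expPart B m = m! * Σ_{k=0}^{m} B^k / k!   (= Σ_k B^k · m!/k!, a natural number)
-- via expPart B 0 = 1, expPart B (m+1) = (m+1)·expPart B m + B^(m+1).
expPart : ℕ → ℕ → ℕ
expPart B zero = 1
expPart B (suc m) = suc m * expPart B m + B ^ suc m

-- The real inequality  x · e^B ≤ y  (x, y, B ∈ ℕ), expressed exactly via the
-- increasing partial sums of the exponential series: e^B = sup_m Σ_{k≤m} B^k/k!.
MulExpLe : ℕ → ℕ → ℕ → Set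
MulExpLe x B y = ∀ m → x * expPart B m ≤ y * m !

module Submission where

-- Put J s i = K s i + Kdbl r s i.  Both sequences are bounded by J, and J obeys
-- the single recursive inequality
--   J (s+3) (i+2) ≤ 2 · J (s+2) (i+2) + J (s+3) (i+1) · (J (s+1) (i+2) + 2),
-- so every upper bound for s ≥ 6 is proved for J.

open import Defs
open import Data.Nat.Base
open import Data.Nat.Properties
open import Data.Nat.Divisibility using (_∣_; divides)
open import Data.Nat.Combinatorics using (_C_; nCk+nC[k+1]≡[n+1]C[k+1]; k>n⇒nCk≡0)
open import Data.Nat.DivMod using (m*n/n≡m; +-distrib-/; m*n%n≡0)
open import Data.Product using (∃-syntax; _×_; _,_; proj₁; proj₂)
open import Data.Sum using (_⊎_; inj₁; inj₂)
open import Data.Empty using (⊥-elim)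
open import Relation.Nullary using (¬_)
open import Relation.Binary.PropositionalEquality
  using (_≡_; refl; sym; trans; cong; cong₂; subst; subst₂; module ≡-Reasoning)
open import Data.Nat.Tactic.RingSolver using (solve-∀)

induction-from : (P : ℕ → Set) (N : ℕ) → P N → (∀ i → N ≤ i → P i → P (suc i)) →
                 ∀ i → N ≤ i → P i
induction-from P N base step i N≤i = subst P (m∸n+n≡m N≤i) (from (i ∸ N))
  where
  from : ∀ d → P (d + N)
  from zero = base
  from (suc d) = step (d + N) (m≤n+m N d) (from d)

≤-by-sum : ∀ {x z} y → x + y ≡ z → x ≤ z
≤-by-sum {x} y eq = ≤-trans (m≤m+n x y) (≤-reflexive eq)

n<2^n : ∀ n → n < 2 ^ n
n<2^n zero = s≤s z≤n
n<2^n (suc n) = begin-strict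
  suc n        <⟨ s≤s (n<2^n n) ⟩
  suc (2 ^ n)  ≤⟨ +-monoˡ-≤ (2 ^ n) (m^n>0 2 n) ⟩
  2 ^ n + 2 ^ n ≡⟨ cong (2 ^ n +_) (sym (+-identityʳ _)) ⟩
  2 ^ suc n    ∎
  where open ≤-Reasoning

^-distribʳ-* : ∀ a b n → (a * b) ^ n ≡ a ^ n * b ^ n
^-distribʳ-* a b zero = refl
^-distribʳ-* a b (suc n) = trans (cong ((a * b) *_) (^-distribʳ-* a b n)) (swap a b (a ^ n) (b ^ n))
  where
  swap : ∀ a b x y → a * b * (x * y) ≡ a * x * (b * y)
  swap = solve-∀

^-product-bound : ∀ n {a b w} → a * b ≤ w → a ^ n * b ^ n ≤ w ^ n
^-product-bound n {a} {b} ab≤w = ≤-trans (≤-reflexive (sym (^-distribʳ-* a b n))) (^-monoˡ-≤ n ab≤w)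

-- 2^x + 4 ≤ 2^(x+3): absorbs the additive constants of the recursion.
2^+4≤2^[+3] : ∀ x → 2 ^ x + 4 ≤ 2 ^ (x + 3)
2^+4≤2^[+3] x = begin
  2 ^ x + 4                       ≤⟨ +-monoʳ-≤ (2 ^ x) (*-monoʳ-≤ 4 (m^n>0 2 x)) ⟩
  2 ^ x + 4 * 2 ^ x               ≤⟨ +-monoˡ-≤ (4 * 2 ^ x) (m≤m+n (2 ^ x) (3 * 2 ^ x)) ⟩
  2 ^ x + 3 * 2 ^ x + 4 * 2 ^ x  ≡⟨ eight (2 ^ x) ⟩
  2 ^ x * 2 ^ 3                   ≡⟨ sym (^-distribˡ-+-* 2 x 3) ⟩
  2 ^ (x + 3)                     ∎
  where
  open ≤-Reasoning
  eight : ∀ p → p + 3 * p + 4 * p ≡ p * 8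
  eight = solve-∀

square≤2^ : ∀ n → n * n ≤ 2 * 2 ^ n
square≤2^ zero = z≤n
square≤2^ (suc n) = begin
  suc n * suc n          ≡⟨ expand n ⟩
  n * n + (2 * n + 1)    ≤⟨ +-mono-≤ (square≤2^ n) linear ⟩
  2 * 2 ^ n + 2 * 2 ^ n  ≡⟨ double (2 ^ n) ⟩
  2 * 2 ^ suc n          ∎
  where
  open ≤-Reasoning
  expand : ∀ n → suc n * suc n ≡ n * n + (2 * n + 1)
  expand = solve-∀
  double : ∀ p → 2 * p + 2 * p ≡ 2 * (2 * p)
  double = solve-∀
  linear : 2 * n + 1 ≤ 2 * 2 ^ n
  linear = begin
    2 * n + 1  ≤⟨ m≤n+m (2 * n + 1) 1 ⟩
    1 + (2 * n + 1) ≡⟨ cong suc (+-comm (2 * n) 1) ⟩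
    2 + 2 * n  ≡⟨ sym (*-suc 2 n) ⟩
    2 * suc n  ≤⟨ *-monoʳ-≤ 2 (n<2^n n) ⟩
    2 * 2 ^ n  ∎

factorial-absorbs : ∀ d n → n ! * suc d ≤ (suc d + n) !
factorial-absorbs zero n = ≤-trans (≤-reflexive (*-identityʳ (n !))) (m≤m+n (n !) (n * n !))
factorial-absorbs (suc d) n = begin
  n ! * suc (suc d)                  ≡⟨ *-suc (n !) (suc d) ⟩
  n ! + n ! * suc d                  ≤⟨ +-mono-≤ (factorial-mono (suc d) n) (factorial-absorbs d n) ⟩
  (suc d + n) ! + (suc d + n) !      ≤⟨ +-monoʳ-≤ ((suc d + n) !) (m≤m+n ((suc d + n) !) _) ⟩
  (suc (suc d) + n) !                ∎
  where
  open ≤-Reasoning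
  factorial-mono : ∀ d m → m ! ≤ (d + m) !
  factorial-mono zero m = ≤-refl
  factorial-mono (suc d) m = ≤-trans (factorial-mono d m) (m≤n*m ((d + m) !) (suc (d + m)))

square*factorial : ∀ n → (n * n) * n ! ≤ (2 + n) !
square*factorial n = begin
  (n * n) * n !                ≤⟨ *-monoˡ-≤ (n !) (*-mono-≤ (n≤1+n n) (≤-trans (n≤1+n n) (n≤1+n (suc n)))) ⟩
  (suc n * suc (suc n)) * n !  ≡⟨ reassoc n (n !) ⟩
  (2 + n) !                    ∎
  where
  open ≤-Reasoning
  reassoc : ∀ n f → (suc n * suc (suc n)) * f ≡ suc (suc n) * (suc n * f)
  reassoc = solve-∀

2^≤factorial : ∀ m → 2 ^ m ≤ (suc m) !
2^≤factorial zero = ≤-refl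
2^≤factorial (suc m) = begin
  2 * 2 ^ m                ≤⟨ *-monoʳ-≤ 2 (2^≤factorial m) ⟩
  2 * (suc m) !            ≤⟨ *-monoˡ-≤ ((suc m) !) (s≤s (s≤s (z≤n {m}))) ⟩
  suc (suc m) * (suc m) !  ∎
  where open ≤-Reasoning

-- Binomial coefficients by Pascal's rule; they agree with the library's _C_
-- (binom≡C), but compute by the recursion that the inductions below follow.
binom : ℕ → ℕ → ℕ
binom n zero = 1
binom zero (suc k) = 0
binom (suc n) (suc k) = binom n k + binom n (suc k)

binom≡C : ∀ n k → binom n k ≡ n C k
binom≡C n zero = refl
binom≡C zero (suc k) = sym (k>n⇒nCk≡0 {0} {suc k} (s≤s z≤n))
binom≡C (suc n) (suc k) =
  trans (cong₂ _+_ (binom≡C n k) (binom≡C n (suc k))) (nCk+nC[k+1]≡[n+1]C[k+1] n k)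

binom-pos : ∀ n k → k ≤ n → 1 ≤ binom n k
binom-pos n zero _ = ≤-refl
binom-pos (suc n) (suc k) (s≤s k≤n) = ≤-trans (binom-pos n k k≤n) (m≤m+n _ _)

binom-1 : ∀ n → binom n 1 ≡ n
binom-1 zero = refl
binom-1 (suc n) = cong suc (binom-1 n)

binom-2 : ∀ n → 2 * binom n 2 + n ≡ n * n
binom-2 zero = refl
binom-2 (suc n) = begin
  2 * (binom n 1 + binom n 2) + suc n ≡⟨ cong (λ z → 2 * (z + binom n 2) + suc n) (binom-1 n) ⟩
  2 * (n + binom n 2) + suc n         ≡⟨ regroup n (binom n 2) ⟩
  (2 * binom n 2 + n) + (2 * n + 1)   ≡⟨ cong (_+ (2 * n + 1)) (binom-2 n) ⟩
  n * n + (2 * n + 1)                 ≡⟨ square n ⟩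
  suc n * suc n                       ∎
  where
  open ≡-Reasoning
  regroup : ∀ n b → 2 * (n + b) + suc n ≡ (2 * b + n) + (2 * n + 1)
  regroup = solve-∀
  square : ∀ n → n * n + (2 * n + 1) ≡ suc n * suc n
  square = solve-∀

binom-monoˡ : ∀ {n m} k → n ≤ m → binom n k ≤ binom m k
binom-monoˡ {n} {m} k n≤m = subst (λ x → binom n k ≤ binom x k) (m∸n+n≡m n≤m) (shift (m ∸ n))
  where
  step : ∀ n k → binom n k ≤ binom (suc n) k
  step n zero = ≤-refl
  step n (suc k) = m≤n+m _ _
  shift : ∀ d → binom n k ≤ binom (d + n) k
  shift zero = ≤-refl
  shift (suc d) = ≤-trans (shift d) (step (d + n) k)

binom-diag : ∀ n k → binom n k ≤ binom (suc n) (suc k)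
binom-diag n k = m≤m+n _ _

-- Each unit added to n adds at least one to C(n,k+1): C(n,k+1) + d ≤ C(m,k+1)
-- whenever k ≤ n and d + n ≤ m.
binom-absorbs : ∀ d {n m} k → k ≤ n → d + n ≤ m → binom n (suc k) + d ≤ binom m (suc k)
binom-absorbs d {n} k k≤n d+n≤m = ≤-trans (grows d) (binom-monoˡ (suc k) d+n≤m)
  where
  grows : ∀ d → binom n (suc k) + d ≤ binom (d + n) (suc k)
  grows zero = ≤-reflexive (+-identityʳ _)
  grows (suc d) = begin
    binom n (suc k) + suc d         ≡⟨ +-suc _ d ⟩
    suc (binom n (suc k) + d)       ≤⟨ s≤s (grows d) ⟩
    suc (binom (d + n) (suc k))     ≡⟨ +-comm 1 _ ⟩
    binom (d + n) (suc k) + 1       ≤⟨ +-monoʳ-≤ (binom (d + n) (suc k)) (binom-pos (d + n) k (≤-trans k≤n (m≤n+m n d))) ⟩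
    binom (d + n) (suc k) + binom (d + n) k ≡⟨ +-comm _ (binom (d + n) k) ⟩
    binom (suc d + n) (suc k)       ∎
    where open ≤-Reasoning

below-2^binom : ∀ x {m} k → x + k ≤ m → x ≤ 2 ^ binom m (suc k)
below-2^binom x {m} k x+k≤m = ≤-trans (<⇒≤ (n<2^n x)) (^-monoʳ-≤ 2 (begin
  x                            ≤⟨ m≤n+m x (binom k (suc k)) ⟩
  binom k (suc k) + x          ≤⟨ binom-absorbs x k ≤-refl x+k≤m ⟩
  binom m (suc k)              ∎))
  where open ≤-Reasoning

2^-pascal : ∀ n k → 2 ^ binom n (suc k) * 2 ^ binom n (suc (suc k)) ≡ 2 ^ binom (suc n) (suc (suc k))
2^-pascal n k = sym (^-distribˡ-+-* 2 (binom n (suc k)) (binom n (suc (suc k))))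

factorial≤2^binom : ∀ n → n ! ≤ 2 ^ binom n 2
factorial≤2^binom zero = s≤s z≤n
factorial≤2^binom (suc n) = begin
  suc n * n !            ≤⟨ *-mono-≤ (n<2^n n) (factorial≤2^binom n) ⟩
  2 ^ n * 2 ^ binom n 2  ≡⟨ cong (λ z → 2 ^ z * 2 ^ binom n 2) (sym (binom-1 n)) ⟩
  2 ^ binom n 1 * 2 ^ binom n 2 ≡⟨ 2^-pascal n 0 ⟩
  2 ^ binom (suc n) 2    ∎
  where open ≤-Reasoning

-- 2^i · (i+3)! ≤ 2^C(i+4,2), because (i+3)! ≤ 2^C(i+3,2) and C(i+4,2) = C(i+3,2) + i + 3.
2^*factorial≤2^binom : ∀ i → 2 ^ i * (3 + i) ! ≤ 2 ^ binom (4 + i) 2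
2^*factorial≤2^binom i = begin
  2 ^ i * (3 + i) !                  ≤⟨ *-monoʳ-≤ (2 ^ i) (factorial≤2^binom (3 + i)) ⟩
  2 ^ i * 2 ^ binom (3 + i) 2        ≡⟨ sym (^-distribˡ-+-* 2 i _) ⟩
  2 ^ (i + binom (3 + i) 2)          ≤⟨ ^-monoʳ-≤ 2 (+-monoˡ-≤ (binom (3 + i) 2) i≤) ⟩
  2 ^ (binom (3 + i) 1 + binom (3 + i) 2) ≡⟨⟩
  2 ^ binom (4 + i) 2                ∎
  where
  open ≤-Reasoning
  i≤ : i ≤ binom (3 + i) 1
  i≤ = ≤-trans (m≤n+m i 3) (≤-reflexive (sym (binom-1 (3 + i))))

kdbl₂ : ℕ → ℕ
kdbl₂ r = 2 * 6 ^ (r ∸ 1)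

-- For s ≥ 2 (and i ≥ 1) K s i ≥ 2, so the truncated subtraction K ∸ 2 in the
-- recursion is the genuine one.
K≥2 : ∀ s i → 2 ≤ K (2 + s) (suc i)
K≥2 zero i = ≤-refl
K≥2 (suc s) zero = ≤-trans (K≥2 s 0) (m≤n*m _ 2)
K≥2 (suc s) (suc i) = ≤-trans (≤-trans (K≥2 s (suc i)) (m≤n*m _ 2)) (m≤m+n _ _)

K3-closed : ∀ i → K 3 (suc i) ≡ 2 * suc i + 2
K3-closed zero = refl
K3-closed (suc i) = begin
  4 + 1 * (K 3 (suc i) ∸ 2)      ≡⟨ cong (λ x → 4 + 1 * (x ∸ 2)) (K3-closed i) ⟩
  4 + 1 * (2 * suc i + 2 ∸ 2)    ≡⟨ cong (λ x → 4 + 1 * x) (m+n∸n≡m (2 * suc i) 2) ⟩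
  4 + 1 * (2 * suc i)            ≡⟨ normalise i ⟩
  2 * suc (suc i) + 2            ∎
  where
  open ≡-Reasoning
  normalise : ∀ i → 4 + 1 * (2 * suc i) ≡ 2 * suc (suc i) + 2
  normalise = solve-∀

Kdbl3-closed : ∀ r i → Kdbl r 3 (suc i) + 5 ≡ 3 * (suc i * suc i) + 3 * suc i + 2 * kdbl₂ r * suc i
Kdbl3-closed r zero = base (kdbl₂ r)
  where
  base : ∀ d → 2 * d + 1 + 5 ≡ 3 * (1 * 1) + 3 * 1 + 2 * d * 1
  base = solve-∀
Kdbl3-closed r (suc i) = begin
  Kdbl r 3 (suc i) + 2 * d + (1 + 2) * K 3 (suc i) + 5
    ≡⟨ cong (λ x → Kdbl r 3 (suc i) + 2 * d + (1 + 2) * x + 5) (K3-closed i) ⟩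
  Kdbl r 3 (suc i) + 2 * d + 3 * (2 * suc i + 2) + 5
    ≡⟨ regroup (Kdbl r 3 (suc i)) d i ⟩
  (Kdbl r 3 (suc i) + 5) + 2 * d + 6 * i + 12
    ≡⟨ cong (λ x → x + 2 * d + 6 * i + 12) (Kdbl3-closed r i) ⟩
  3 * (suc i * suc i) + 3 * suc i + 2 * d * suc i + 2 * d + 6 * i + 12
    ≡⟨ next-square d i ⟩
  3 * (suc (suc i) * suc (suc i)) + 3 * suc (suc i) + 2 * d * suc (suc i) ∎
  where
  open ≡-Reasoning
  d = kdbl₂ r
  regroup : ∀ x d i → x + 2 * d + 3 * (2 * suc i + 2) + 5 ≡ (x + 5) + 2 * d + 6 * i + 12
  regroup = solve-∀
  next-square : ∀ d i → 3 * (suc i * suc i) + 3 * suc i + 2 * d * suc i + 2 * d + 6 * i + 12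
                      ≡ 3 * (suc (suc i) * suc (suc i)) + 3 * suc (suc i) + 2 * d * suc (suc i)
  next-square = solve-∀

Kdbl3-upper : ∀ r i → Kdbl r 3 (suc i) + 5 ≤ (6 + 2 * kdbl₂ r) * (suc i * suc i)
Kdbl3-upper r i = begin
  Kdbl r 3 j + 5                               ≡⟨ Kdbl3-closed r i ⟩
  3 * (j * j) + 3 * j + 2 * d * j              ≤⟨ +-mono-≤ (+-monoʳ-≤ (3 * (j * j)) (*-monoʳ-≤ 3 j≤j²)) (*-monoʳ-≤ (2 * d) j≤j²) ⟩
  3 * (j * j) + 3 * (j * j) + 2 * d * (j * j)  ≡⟨ collect d (j * j) ⟩
  (6 + 2 * d) * (j * j)                        ∎
  where
  open ≤-Reasoning
  j = suc i
  d = kdbl₂ r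
  j≤j² : j ≤ j * j
  j≤j² = m≤m*n j j
  collect : ∀ d x → 3 * x + 3 * x + 2 * d * x ≡ (6 + 2 * d) * x
  collect = solve-∀

Kdbl3-lower : ∀ r i → suc i * suc i ≤ Kdbl r 3 (suc i)
Kdbl3-lower r i = +-cancelʳ-≤ 5 _ _ (begin
  j * j + 5                                          ≤⟨ +-monoʳ-≤ (j * j) five≤ ⟩
  j * j + (2 * (j * j) + 3 * j)                      ≤⟨ m≤m+n _ (2 * d * j) ⟩
  j * j + (2 * (j * j) + 3 * j) + 2 * d * j          ≡⟨ collect d j ⟩
  3 * (j * j) + 3 * j + 2 * d * j                    ≡⟨ sym (Kdbl3-closed r i) ⟩
  Kdbl r 3 j + 5                                     ∎)
  where
  open ≤-Reasoning
  j = suc i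
  d = kdbl₂ r
  five≤ : 5 ≤ 2 * (j * j) + 3 * j
  five≤ = +-mono-≤ (*-monoʳ-≤ 2 (s≤s (z≤n {i + i * suc i}))) (*-monoʳ-≤ 3 (s≤s (z≤n {i})))
  collect : ∀ d j → j * j + (2 * (j * j) + 3 * j) + 2 * d * j ≡ 3 * (j * j) + 3 * j + 2 * d * j
  collect = solve-∀

K4-closed : ∀ i → K 4 (suc i) + 4 * i + 12 ≡ 20 * 2 ^ i
K4-closed zero = refl
K4-closed (suc i) = begin
  2 * K 3 (suc (suc i)) + 2 * (K 4 (suc i) ∸ 2) + 4 * suc i + 12
    ≡⟨ cong (λ x → 2 * x + 2 * (K 4 (suc i) ∸ 2) + 4 * suc i + 12) (K3-closed (suc i)) ⟩
  2 * (2 * suc (suc i) + 2) + 2 * b + 4 * suc i + 12 ≡⟨ regroup b i ⟩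
  2 * ((b + 2) + 4 * i + 12)       ≡⟨ cong (λ x → 2 * (x + 4 * i + 12)) (m∸n+n≡m (K≥2 2 i)) ⟩
  2 * (K 4 (suc i) + 4 * i + 12)   ≡⟨ cong (2 *_) (K4-closed i) ⟩
  2 * (20 * 2 ^ i)                 ≡⟨ *-comm 2 (20 * 2 ^ i) ⟩
  20 * 2 ^ i * 2                   ≡⟨ *-assoc 20 (2 ^ i) 2 ⟩
  20 * (2 ^ i * 2)                 ≡⟨ cong (20 *_) (*-comm (2 ^ i) 2) ⟩
  20 * 2 ^ suc i                   ∎
  where
  open ≡-Reasoning
  b = K 4 (suc i) ∸ 2
  regroup : ∀ b i → 2 * (2 * suc (suc i) + 2) + 2 * b + 4 * suc i + 12 ≡ 2 * ((b + 2) + 4 * i + 12)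
  regroup = solve-∀

K4-upper : ∀ i → K 4 (suc i) ≤ 20 * 2 ^ i
K4-upper i = ≤-trans (≤-trans (m≤m+n _ (4 * i)) (m≤m+n _ 12)) (≤-reflexive (K4-closed i))

K4-lower : ∀ i → 2 * 2 ^ i ≤ K 4 (suc i)
K4-lower i = +-cancelʳ-≤ (18 * 2 ^ i) _ _ (begin
  2 * p + 18 * p            ≡⟨ collect p ⟩
  20 * p                    ≡⟨ sym (K4-closed i) ⟩
  K 4 (suc i) + 4 * i + 12  ≡⟨ +-assoc (K 4 (suc i)) (4 * i) 12 ⟩
  K 4 (suc i) + (4 * i + 12) ≤⟨ +-monoʳ-≤ (K 4 (suc i)) small ⟩
  K 4 (suc i) + 18 * p      ∎)
  where
  open ≤-Reasoning
  p = 2 ^ i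
  collect : ∀ p → 2 * p + 18 * p ≡ 20 * p
  collect = solve-∀
  sixteen : ∀ p → 4 * p + 12 * p ≡ 16 * p
  sixteen = solve-∀
  small : 4 * i + 12 ≤ 18 * p
  small = begin
    4 * i + 12      ≤⟨ +-mono-≤ (*-monoʳ-≤ 4 (<⇒≤ (n<2^n i))) (*-monoʳ-≤ 12 (m^n>0 2 i)) ⟩
    4 * p + 12 * p  ≡⟨ sixteen p ⟩
    16 * p          ≤⟨ *-monoˡ-≤ p (m≤m+n 16 2) ⟩
    18 * p          ∎

kdbl4-const : ℕ → ℕ
kdbl4-const r = 4 * kdbl₂ r + 3 + (136 + 52 * kdbl₂ r)

-- s = 4: Kdbl 4 i ≤ kdbl4-const · 2^i, via the affine bound 4d + 3 + (136 + 52d)·2^(i-1)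
-- that survives the induction.
Kdbl4-upper : ∀ r i → Kdbl r 4 (suc i) ≤ kdbl4-const r * 2 ^ suc i
Kdbl4-upper r i = begin
  Kdbl r 4 (suc i)                                 ≤⟨ affine i ⟩
  4 * d + 3 + g * 2 ^ i                            ≤⟨ +-mono-≤ (m≤m*n (4 * d + 3) (2 ^ suc i) {{m^n≢0 2 (suc i)}}) (*-monoʳ-≤ g (m≤n*m (2 ^ i) 2)) ⟩
  (4 * d + 3) * 2 ^ suc i + g * 2 ^ suc i          ≡⟨ sym (*-distribʳ-+ (2 ^ suc i) (4 * d + 3) g) ⟩
  kdbl4-const r * 2 ^ suc i                        ∎
  where
  open ≤-Reasoning
  d = kdbl₂ r
  g = 136 + 52 * d
  Kdbl3≤ : ∀ i → Kdbl r 3 (suc (suc i)) ≤ (6 + 2 * d) * (8 * 2 ^ i)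
  Kdbl3≤ i = ≤-trans (m≤m+n _ 5) (≤-trans (Kdbl3-upper r (suc i))
               (*-monoʳ-≤ (6 + 2 * d) (≤-trans (square≤2^ (suc (suc i))) (≤-reflexive (eight (2 ^ i))))))
    where
    eight : ∀ p → 2 * (2 * (2 * p)) ≡ 8 * p
    eight = solve-∀
  base : ∀ d → 2 * (2 * d + 1) + 1 ≡ 4 * d + 3
  base = solve-∀
  collect : ∀ d p → 4 * d + 3 + (136 + 52 * d) * p + 2 * ((6 + 2 * d) * (8 * p)) + (d + 2) * (20 * p)
                  ≡ 4 * d + 3 + (136 + 52 * d) * (2 * p)
  collect = solve-∀
  affine : ∀ i → Kdbl r 4 (suc i) ≤ 4 * d + 3 + g * 2 ^ i
  affine zero = ≤-trans (≤-reflexive (base d)) (m≤m+n _ _)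
  affine (suc i) = begin
    Kdbl r 4 (suc i) + 2 * Kdbl r 3 (suc (suc i)) + (d + 2) * K 4 (suc i)
      ≤⟨ +-mono-≤ (+-mono-≤ (affine i) (*-monoʳ-≤ 2 (Kdbl3≤ i))) (*-monoʳ-≤ (d + 2) (K4-upper i)) ⟩
    4 * d + 3 + g * 2 ^ i + 2 * ((6 + 2 * d) * (8 * 2 ^ i)) + (d + 2) * (20 * 2 ^ i)
      ≡⟨ collect d (2 ^ i) ⟩
    4 * d + 3 + g * 2 ^ suc i ∎

-- Kdbl 4 i ≥ 2^i, already from its term (kdbl₂ + 2)·K 4 (i−1).
Kdbl4-lower : ∀ r i → 2 * 2 ^ i ≤ Kdbl r 4 (suc i)
Kdbl4-lower r zero = ≤-trans (*-monoʳ-≤ 2 (m≤n+m 1 (2 * kdbl₂ r))) (m≤m+n _ 1)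
Kdbl4-lower r (suc i) = begin
  2 * (2 * 2 ^ i)               ≤⟨ *-monoʳ-≤ 2 (K4-lower i) ⟩
  2 * K 4 (suc i)               ≤⟨ *-monoˡ-≤ (K 4 (suc i)) (m≤n+m 2 (kdbl₂ r)) ⟩
  (kdbl₂ r + 2) * K 4 (suc i)   ≤⟨ m≤n+m _ _ ⟩
  Kdbl r 4 (suc i) + 2 * Kdbl r 3 (suc (suc i)) + (kdbl₂ r + 2) * K 4 (suc i) ∎
  where open ≤-Reasoning

-- s = 5: K 5 i ≤ 14 · 2^i · (i+1)!, strengthened by an additive term for the induction.
K5-upper-strong : ∀ i → K 5 (suc i) + 20 * 2 ^ suc i ≤ 14 * 2 ^ suc i * (suc (suc i)) !
K5-upper-strong zero = ≤-refl
K5-upper-strong (suc i) = begin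
  2 * K 4 (suc (suc i)) + K 3 (suc (suc i)) * (K 5 (suc i) ∸ 2) + 20 * 2 ^ suc (suc i)
    ≤⟨ +-monoˡ-≤ _ (+-mono-≤ (*-monoʳ-≤ 2 (K4-upper (suc i))) K3*K5) ⟩
  2 * (20 * 2 ^ suc i) + (2 * suc (suc i) + 2) * k + 20 * 2 ^ suc (suc i)
    ≡⟨ regroup k p i ⟩
  (2 * i + 6) * k + 160 * p                          ≤⟨ m≤m+n _ _ ⟩
  (2 * i + 6) * k + 160 * p + (80 + 80 * i) * p      ≡⟨ factor k p i ⟩
  (2 * i + 6) * (k + 20 * 2 ^ suc i)                 ≤⟨ *-monoʳ-≤ (2 * i + 6) (K5-upper-strong i) ⟩
  (2 * i + 6) * (14 * 2 ^ suc i * (suc (suc i)) !)   ≡⟨ next-factorial i p ((suc (suc i)) !) ⟩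
  14 * 2 ^ suc (suc i) * (suc (suc (suc i))) !       ∎
  where
  open ≤-Reasoning
  k = K 5 (suc i)
  p = 2 ^ i
  K3*K5 : K 3 (suc (suc i)) * (k ∸ 2) ≤ (2 * suc (suc i) + 2) * k
  K3*K5 = ≤-trans (≤-reflexive (cong (_* (k ∸ 2)) (K3-closed (suc i)))) (*-monoʳ-≤ (2 * suc (suc i) + 2) (m∸n≤m k 2))
  regroup : ∀ k p i → 2 * (20 * (2 * p)) + (2 * suc (suc i) + 2) * k + 20 * (2 * (2 * p))
                    ≡ (2 * i + 6) * k + 160 * p
  regroup = solve-∀
  factor : ∀ k p i → (2 * i + 6) * k + 160 * p + (80 + 80 * i) * p ≡ (2 * i + 6) * (k + 20 * (2 * p))
  factor = solve-∀
  next-factorial : ∀ i p f → (2 * i + 6) * (14 * (2 * p) * f) ≡ 14 * (2 * (2 * p)) * ((3 + i) * f)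
  next-factorial = solve-∀

K5-upper : ∀ i → K 5 (suc i) ≤ 14 * 2 ^ suc i * (suc (suc i)) !
K5-upper i = ≤-trans (m≤m+n _ _) (K5-upper-strong i)

kdbl5-const : ℕ → ℕ
kdbl5-const r = 4 * kdbl4-const r + 14 * (6 + 2 * kdbl₂ r) + (8 * kdbl₂ r + 7)

Kdbl5-upper : ∀ r i → Kdbl r 5 (suc i) ≤ kdbl5-const r * 2 ^ suc i * (4 + i) !
Kdbl5-upper r zero = ≤-trans (≤-reflexive (base (kdbl₂ r)))
  (≤-trans (m≤n+m (8 * kdbl₂ r + 7) (4 * kdbl4-const r + 14 * (6 + 2 * kdbl₂ r)))
  (≤-trans (m≤m*n (kdbl5-const r) 2) (m≤m*n (kdbl5-const r * 2) 24)))
  where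
  base : ∀ d → 2 * (2 * (2 * d + 1) + 1) + 1 ≡ 8 * d + 7
  base = solve-∀
Kdbl5-upper r (suc i) = begin
  Kdbl r 5 (suc i) + 2 * Kdbl r 4 (suc (suc i)) + (Kdbl r 3 (suc (suc i)) + 2) * K 5 (suc i)
    ≤⟨ +-mono-≤ (+-mono-≤ (Kdbl5-upper r i) (*-monoʳ-≤ 2 (Kdbl4-upper r (suc i)))) (*-mono-≤ Kdbl3≤ (K5-upper i)) ⟩
  h * q * f + 2 * (b * (2 * q)) + (a * (m * m)) * (14 * q * m !)
    ≤⟨ +-mono-≤ (+-monoʳ-≤ (h * q * f) Kdbl4-term) (≤-reflexive (regroup a m q (m !))) ⟩
  h * q * f + 4 * b * q * f + 14 * a * q * ((m * m) * m !)
    ≤⟨ +-monoʳ-≤ (h * q * f + 4 * b * q * f) (*-monoʳ-≤ (14 * a * q) (square*factorial m)) ⟩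
  h * q * f + 4 * b * q * f + 14 * a * q * f  ≡⟨ collect h (4 * b) (14 * a) q f ⟩
  (h + (4 * b + 14 * a)) * (q * f)            ≤⟨ *-monoˡ-≤ (q * f) (+-monoʳ-≤ h (m≤m+n _ (8 * kdbl₂ r + 7))) ⟩
  (h + h) * (q * f)                           ≡⟨ double h q f ⟩
  h * (2 * q) * (1 * f)                       ≤⟨ *-monoʳ-≤ (h * (2 * q)) (*-monoˡ-≤ f (s≤s (z≤n {4 + i}))) ⟩
  h * (2 * q) * ((5 + i) * f)                 ∎
  where
  open ≤-Reasoning
  h = kdbl5-const r
  a = 6 + 2 * kdbl₂ r
  b = kdbl4-const r
  q = 2 ^ suc i
  m = suc (suc i)
  f = (4 + i) !
  Kdbl3≤ : Kdbl r 3 (suc (suc i)) + 2 ≤ a * (m * m)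
  Kdbl3≤ = ≤-trans (+-monoʳ-≤ (Kdbl r 3 (suc (suc i))) (m≤m+n 2 3)) (Kdbl3-upper r (suc i))
  Kdbl4-term : 2 * (b * (2 * q)) ≤ 4 * b * q * f
  Kdbl4-term = ≤-trans (≤-reflexive (trans (quadruple b q) (sym (*-identityʳ _))))
                       (*-monoʳ-≤ (4 * b * q) (1≤n! (4 + i)))
    where
    quadruple : ∀ b q → 2 * (b * (2 * q)) ≡ 4 * b * q
    quadruple = solve-∀
  regroup : ∀ a m q g → (a * (m * m)) * (14 * q * g) ≡ 14 * a * q * ((m * m) * g)
  regroup = solve-∀
  collect : ∀ h x y q f → h * q * f + x * q * f + y * q * f ≡ (h + (x + y)) * (q * f)
  collect = solve-∀
  double : ∀ h q f → (h + h) * (q * f) ≡ h * (2 * q) * (1 * f)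
  double = solve-∀

J : ℕ → ℕ → ℕ → ℕ
J r s i = K s i + Kdbl r s i

K≤J : ∀ r s i → K s i ≤ J r s i
K≤J r s i = m≤m+n _ _

Kdbl≤J : ∀ r s i → Kdbl r s i ≤ J r s i
Kdbl≤J r s i = m≤n+m _ _

J-recursion : ∀ r s i →
  J r (3 + s) (2 + i) ≤ 2 * J r (2 + s) (2 + i) + J r (3 + s) (1 + i) * (J r (1 + s) (2 + i) + 2)
J-recursion r s i = begin
  (2 * a + b * (c ∸ 2)) + (c' + 2 * a' + (b' + 2) * c)
    ≤⟨ +-monoˡ-≤ (c' + 2 * a' + (b' + 2) * c) (+-monoʳ-≤ (2 * a) (*-monoʳ-≤ b (m∸n≤m c 2))) ⟩
  (2 * a + b * c) + (c' + 2 * a' + (b' + 2) * c)          ≡⟨ regroup a b c a' b' c' ⟩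
  2 * (a + a') + c * (b + b' + 2) + c' * 1                ≤⟨ +-monoʳ-≤ (2 * (a + a') + c * (b + b' + 2)) (*-monoʳ-≤ c' (m≤n+m 1 (b + b' + 1))) ⟩
  2 * (a + a') + c * (b + b' + 2) + c' * (b + b' + 1 + 1) ≡⟨ factor a b c a' b' c' ⟩
  2 * (a + a') + (c + c') * (b + b' + 2)                  ∎
  where
  open ≤-Reasoning
  a = K (2 + s) (2 + i)
  b = K (1 + s) (2 + i)
  c = K (3 + s) (1 + i)
  a' = Kdbl r (2 + s) (2 + i)
  b' = Kdbl r (1 + s) (2 + i)
  c' = Kdbl r (3 + s) (1 + i)
  regroup : ∀ a b c a' b' c' → (2 * a + b * c) + (c' + 2 * a' + (b' + 2) * c)
                             ≡ 2 * (a + a') + c * (b + b' + 2) + c' * 1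
  regroup = solve-∀
  factor : ∀ a b c a' b' c' → 2 * (a + a') + c * (b + b' + 2) + c' * (b + b' + 1 + 1)
                            ≡ 2 * (a + a') + (c + c') * (b + b' + 2)
  factor = solve-∀

J4-upper : ∀ r i → J r 4 (suc i) ≤ (kdbl4-const r + 10) * 2 ^ suc i
J4-upper r i = begin
  K 4 (suc i) + Kdbl r 4 (suc i)                ≤⟨ +-mono-≤ (K4-upper i) (Kdbl4-upper r i) ⟩
  20 * 2 ^ i + kdbl4-const r * 2 ^ suc i        ≡⟨ collect (2 ^ i) (kdbl4-const r) ⟩
  (kdbl4-const r + 10) * 2 ^ suc i              ∎
  where
  open ≤-Reasoning
  collect : ∀ p b → 20 * p + b * (2 * p) ≡ (b + 10) * (2 * p)
  collect = solve-∀

j5-const : ℕ → ℕ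
j5-const r = kdbl5-const r + 14

J5-upper : ∀ r i → J r 5 (suc i) ≤ j5-const r * 2 ^ suc i * (4 + i) !
J5-upper r i = begin
  K 5 (suc i) + Kdbl r 5 (suc i)          ≤⟨ +-mono-≤ (K5-upper i) (Kdbl5-upper r i) ⟩
  14 * q * (2 + i) ! + h * q * (4 + i) !   ≤⟨ +-monoˡ-≤ (h * q * (4 + i) !) (*-monoʳ-≤ (14 * q) factorial-step₂) ⟩
  14 * q * (4 + i) ! + h * q * (4 + i) !   ≡⟨ collect q h ((4 + i) !) ⟩
  (h + 14) * q * (4 + i) !                 ∎
  where
  open ≤-Reasoning
  q = 2 ^ suc i
  h = kdbl5-const r
  factorial-step₂ : (2 + i) ! ≤ (4 + i) !
  factorial-step₂ = ≤-trans (m≤n*m ((2 + i) !) (3 + i)) (m≤n*m ((3 + i) !) (4 + i))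
  collect : ∀ q h f → 14 * q * f + h * q * f ≡ (h + 14) * q * f
  collect = solve-∀

CrudeBound : ℕ → ℕ → ℕ → Set
CrudeBound r s k = ∃[ c ] Eventually (λ i → J r s i ≤ 2 ^ binom (i + c) k)

crude-raise : ∀ r s k → CrudeBound r s k → CrudeBound r s (suc k)
crude-raise r s k (c , N , below) = suc c , N , λ i N≤i →
  ≤-trans (below i N≤i) (^-monoʳ-≤ 2 (≤-trans (binom-diag (i + c) k)
    (≤-reflexive (cong (λ z → binom z (suc k)) (sym (+-suc i c))))))

crude-recursion-step : ∀ {U V Y W} x → V ≤ U → Y ≤ U → W ≤ 2 ^ x →
                       2 * V + Y * (W + 2) ≤ U * 2 ^ (x + 3)
crude-recursion-step {U} {V} {Y} {W} x V≤U Y≤U W≤2^x = begin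
  2 * V + Y * (W + 2)      ≤⟨ +-mono-≤ (*-monoʳ-≤ 2 V≤U) (*-mono-≤ Y≤U (+-monoˡ-≤ 2 W≤2^x)) ⟩
  2 * U + U * (2 ^ x + 2)  ≡⟨ collect U (2 ^ x) ⟩
  U * (2 ^ x + 4)          ≤⟨ *-monoʳ-≤ U (2^+4≤2^[+3] x) ⟩
  U * 2 ^ (x + 3)          ∎
  where
  open ≤-Reasoning
  collect : ∀ u p → 2 * u + u * (p + 2) ≡ u * (p + 4)
  collect = solve-∀

-- Crude bounds for J (s+2) of order k+2 and for J (s+1) of order k+1 give one
-- for J (s+3) of order k+2: by Pascal, 2^C(i+1+c,k+2) = 2^C(i+c,k+2) · 2^C(i+c,k+1),
-- and the recursion multiplies the previous value by roughly J (s+1).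
crude-step : ∀ r s k → CrudeBound r (2 + s) (2 + k) → CrudeBound r (1 + s) (1 + k) →
             CrudeBound r (3 + s) (2 + k)
crude-step r s k (b , Nb , bound₂) (a , Na , bound₁) = c , N , induction-from P N base step
  where
  N = suc (Na + Nb + k)
  X = J r (3 + s) N
  c = a + b + 4 + X
  P : ℕ → Set
  P i = J r (3 + s) i ≤ 2 ^ binom (i + c) (2 + k)
  base : P N
  base = below-2^binom X (suc k) (≤-by-sum (Na + Nb + a + b + 4) (arith Na Nb k a b X))
    where
    arith : ∀ Na Nb k a b X → X + suc k + (Na + Nb + a + b + 4) ≡ suc (Na + Nb + k) + (a + b + 4 + X)
    arith = solve-∀
  step : ∀ i → N ≤ i → P i → P (suc i)
  step zero () _
  step (suc i) (s≤s past) previous = begin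
    J r (3 + s) (2 + i)
      ≤⟨ J-recursion r s i ⟩
    2 * J r (2 + s) (2 + i) + J r (3 + s) (1 + i) * (J r (1 + s) (2 + i) + 2)
      ≤⟨ crude-recursion-step x J₂≤U previous (bound₁ (2 + i) (late (≤-trans (m≤m+n Na Nb) (m≤m+n _ k)))) ⟩
    U * 2 ^ (x + 3)
      ≤⟨ *-monoʳ-≤ U (^-monoʳ-≤ 2 x+3≤) ⟩
    U * 2 ^ binom (suc i + c) (suc k)
      ≡⟨ *-comm U _ ⟩
    2 ^ binom (suc i + c) (suc k) * U
      ≡⟨ 2^-pascal (suc i + c) k ⟩
    2 ^ binom (suc (suc i) + c) (2 + k) ∎
    where
    open ≤-Reasoning
    U = 2 ^ binom (suc i + c) (2 + k)
    x = binom (2 + i + a) (suc k)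
    late : ∀ {y} → y ≤ Na + Nb + k → y ≤ 2 + i
    late y≤ = ≤-trans y≤ (≤-trans past (≤-trans (n≤1+n i) (n≤1+n (suc i))))
    J₂≤U : J r (2 + s) (2 + i) ≤ U
    J₂≤U = ≤-trans (bound₂ (2 + i) (late (≤-trans (m≤n+m Nb Na) (m≤m+n _ k))))
                   (^-monoʳ-≤ 2 (binom-monoˡ (2 + k) (≤-by-sum (a + 3 + X) (arith i a b X))))
      where
      arith : ∀ i a b X → 2 + i + b + (a + 3 + X) ≡ suc i + (a + b + 4 + X)
      arith = solve-∀
    x+3≤ : x + 3 ≤ binom (suc i + c) (suc k)
    x+3≤ = binom-absorbs 3 k (≤-trans (late (m≤n+m k _)) (m≤m+n _ a)) (≤-by-sum (b + X) (arith i a b X))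
      where
      arith : ∀ i a b X → 3 + (2 + i + a) + (b + X) ≡ suc i + (a + b + 4 + X)
      arith = solve-∀

crude-J4 : ∀ r → CrudeBound r 4 1
crude-J4 r = z , 1 , below
  where
  z = kdbl4-const r + 10
  below : ∀ i → 1 ≤ i → J r 4 i ≤ 2 ^ binom (i + z) 1
  below (suc i) _ = begin
    J r 4 (suc i)             ≤⟨ J4-upper r i ⟩
    z * 2 ^ suc i             ≤⟨ *-monoˡ-≤ (2 ^ suc i) (<⇒≤ (n<2^n z)) ⟩
    2 ^ z * 2 ^ suc i         ≡⟨ sym (^-distribˡ-+-* 2 z (suc i)) ⟩
    2 ^ (z + suc i)           ≡⟨ cong (2 ^_) (trans (+-comm z (suc i)) (sym (binom-1 (suc i + z)))) ⟩
    2 ^ binom (suc i + z) 1   ∎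
    where open ≤-Reasoning

crude-J5 : ∀ r → CrudeBound r 5 2
crude-J5 r = z + 4 , 1 , below
  where
  z = j5-const r
  below : ∀ i → 1 ≤ i → J r 5 i ≤ 2 ^ binom (i + (z + 4)) 2
  below (suc i) _ = begin
    J r 5 (suc i)                              ≤⟨ J5-upper r i ⟩
    z * 2 ^ suc i * (4 + i) !                  ≤⟨ *-monoˡ-≤ ((4 + i) !) (*-monoˡ-≤ (2 ^ suc i) (<⇒≤ (n<2^n z))) ⟩
    2 ^ z * 2 ^ suc i * (4 + i) !              ≡⟨ *-assoc (2 ^ z) (2 ^ suc i) ((4 + i) !) ⟩
    2 ^ z * (2 ^ suc i * (3 + suc i) !)        ≤⟨ *-monoʳ-≤ (2 ^ z) (2^*factorial≤2^binom (suc i)) ⟩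
    2 ^ z * 2 ^ binom (5 + i) 2                ≡⟨ sym (^-distribˡ-+-* 2 z _) ⟩
    2 ^ (z + binom (5 + i) 2)                  ≡⟨ cong (2 ^_) (+-comm z _) ⟩
    2 ^ (binom (5 + i) 2 + z)                  ≤⟨ ^-monoʳ-≤ 2 (binom-absorbs z 1 (s≤s z≤n) (≤-reflexive (arith z i))) ⟩
    2 ^ binom (suc i + (z + 4)) 2              ∎
    where
    open ≤-Reasoning
    arith : ∀ z i → z + (5 + i) ≡ suc i + (z + 4)
    arith = solve-∀

crude : ∀ r u → CrudeBound r (4 + u * 2) (1 + u) × CrudeBound r (5 + u * 2) (2 + u)
crude r zero = crude-J4 r , crude-J5 r
crude r (suc u) = next-even , crude-step r (4 + u * 2) (suc u) (crude-raise r (6 + u * 2) (2 + u) next-even) odd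
  where
  even = proj₁ (crude r u)
  odd = proj₂ (crude r u)
  next-even : CrudeBound r (6 + u * 2) (2 + u)
  next-even = crude-step r (3 + u * 2) u odd even

-- binomial-sum m g = Σ_j C(m,j) · g j, by Pascal's rule.
binomial-sum : ℕ → (ℕ → ℕ) → ℕ
binomial-sum zero g = g 0
binomial-sum (suc m) g = binomial-sum m g + binomial-sum m (λ j → g (suc j))

binomial-sum-cong : ∀ m {f g : ℕ → ℕ} → (∀ j → f j ≡ g j) → binomial-sum m f ≡ binomial-sum m g
binomial-sum-cong zero f≡g = f≡g 0
binomial-sum-cong (suc m) f≡g = cong₂ _+_ (binomial-sum-cong m f≡g) (binomial-sum-cong m (λ j → f≡g (suc j)))

binomial-sum-+ : ∀ m (f g : ℕ → ℕ) →
                 binomial-sum m (λ j → f j + g j) ≡ binomial-sum m f + binomial-sum m g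
binomial-sum-+ zero f g = refl
binomial-sum-+ (suc m) f g =
  trans (cong₂ _+_ (binomial-sum-+ m f g) (binomial-sum-+ m (λ j → f (suc j)) (λ j → g (suc j))))
        (interchange (binomial-sum m f) (binomial-sum m g) _ _)
  where
  interchange : ∀ a b c d → a + b + (c + d) ≡ a + c + (b + d)
  interchange = solve-∀

binomial-sum-* : ∀ m a (f : ℕ → ℕ) → binomial-sum m (λ j → a * f j) ≡ a * binomial-sum m f
binomial-sum-* zero a f = refl
binomial-sum-* (suc m) a f =
  trans (cong₂ _+_ (binomial-sum-* m a f) (binomial-sum-* m a (λ j → f (suc j)))) (sym (*-distribˡ-+ a _ _))

binomial-sum-mono : ∀ m (f g : ℕ → ℕ) → (∀ j → j ≤ m → f j ≤ g j) → binomial-sum m f ≤ binomial-sum m g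
binomial-sum-mono zero f g f≤g = f≤g 0 z≤n
binomial-sum-mono (suc m) f g f≤g =
  +-mono-≤ (binomial-sum-mono m f g (λ j j≤m → f≤g j (m≤n⇒m≤1+n j≤m)))
           (binomial-sum-mono m (λ j → f (suc j)) (λ j → g (suc j)) (λ j j≤m → f≤g (suc j) (s≤s j≤m)))

binomial-theorem : ∀ m x → binomial-sum m (x ^_) ≡ suc x ^ m
binomial-theorem zero x = refl
binomial-theorem (suc m) x = begin
  binomial-sum m (x ^_) + binomial-sum m (λ j → x * x ^ j) ≡⟨ cong₂ _+_ (binomial-theorem m x) (binomial-sum-* m x (x ^_)) ⟩
  suc x ^ m + x * binomial-sum m (x ^_)                    ≡⟨ cong (λ y → suc x ^ m + x * y) (binomial-theorem m x) ⟩
  suc x * suc x ^ m                                         ∎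
  where open ≡-Reasoning

-- Σ_j C(m+1,j) · j · g j = (m+1) · Σ_j C(m,j) · g (j+1), from j·C(m+1,j) = (m+1)·C(m,j-1).
binomial-sum-weighted : ∀ m (g : ℕ → ℕ) →
  binomial-sum (suc m) (λ j → j * g j) ≡ suc m * binomial-sum m (λ j → g (suc j))
binomial-sum-weighted zero g = refl
binomial-sum-weighted (suc m) g = begin
  binomial-sum (suc m) (λ j → j * g j) + binomial-sum (suc m) (λ j → g (suc j) + j * g (suc j))
    ≡⟨ cong₂ _+_ (binomial-sum-weighted m g) (binomial-sum-+ (suc m) (λ j → g (suc j)) (λ j → j * g (suc j))) ⟩
  suc m * X + (binomial-sum (suc m) (λ j → g (suc j)) + binomial-sum (suc m) (λ j → j * g (suc j)))
    ≡⟨ cong (λ z → suc m * X + (X + Y + z)) (binomial-sum-weighted m (λ j → g (suc j))) ⟩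
  suc m * X + ((X + Y) + suc m * Y) ≡⟨ collect m X Y ⟩
  suc (suc m) * (X + Y)              ∎
  where
  open ≡-Reasoning
  X = binomial-sum m (λ j → g (suc j))
  Y = binomial-sum m (λ j → g (suc (suc j)))
  collect : ∀ m X Y → suc m * X + ((X + Y) + suc m * Y) ≡ suc (suc m) * (X + Y)
  collect = solve-∀

-- The convolution e^(x+1) = e^x · e^1 on partial sums: the binomial transform of
-- expPart x satisfies the defining recursion of expPart (x+1) ...
binomial-sum-expPart-rec : ∀ x m → binomial-sum (suc m) (expPart x)
                                 ≡ suc m * binomial-sum m (expPart x) + suc x ^ suc m
binomial-sum-expPart-rec x zero = cong suc (trans (*-identityʳ (suc x)) (sym (cong suc (*-identityʳ x))))
binomial-sum-expPart-rec x (suc m) = begin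
  F₀ + G + binomial-sum (suc m) (λ j → (expPart x j + j * expPart x j) + x * x ^ j)
    ≡⟨ cong (F₀ + G +_) (binomial-sum-+ (suc m) _ (λ j → x * x ^ j)) ⟩
  F₀ + G + (binomial-sum (suc m) (λ j → expPart x j + j * expPart x j) + binomial-sum (suc m) (λ j → x * x ^ j))
    ≡⟨ cong (F₀ + G +_) (cong₂ _+_ (binomial-sum-+ (suc m) (expPart x) (λ j → j * expPart x j)) powers) ⟩
  F₀ + G + (F₀ + G + binomial-sum (suc m) (λ j → j * expPart x j) + x * p)
    ≡⟨ cong (λ z → F₀ + G + (F₀ + G + z + x * p)) (binomial-sum-weighted m (expPart x)) ⟩
  F₀ + G + (F₀ + G + suc m * G + x * p)
    ≡⟨ cong (λ g → F₀ + g + (F₀ + g + suc m * g + x * p)) G≡ ⟩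
  F₀ + (m * F₀ + p) + (F₀ + (m * F₀ + p) + suc m * (m * F₀ + p) + x * p)
    ≡⟨ collect F₀ m p x ⟩
  suc (suc m) * (F₀ + (m * F₀ + p)) + suc x * p
    ≡⟨ cong (λ g → suc (suc m) * (F₀ + g) + suc x * p) (sym G≡) ⟩
  suc (suc m) * (F₀ + G) + suc x * p ∎
  where
  open ≡-Reasoning
  F₀ = binomial-sum m (expPart x)
  G = binomial-sum m (λ j → expPart x (suc j))
  p = suc x ^ suc m
  G≡ : G ≡ m * F₀ + p
  G≡ = +-cancelˡ-≡ F₀ G (m * F₀ + p) (trans (binomial-sum-expPart-rec x m) (+-assoc F₀ (m * F₀) p))
  powers : binomial-sum (suc m) (λ j → x * x ^ j) ≡ x * p
  powers = trans (binomial-sum-* (suc m) x (x ^_)) (cong (x *_) (binomial-theorem (suc m) x))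
  collect : ∀ f m p x → f + (m * f + p) + (f + (m * f + p) + suc m * (m * f + p) + x * p)
                      ≡ suc (suc m) * (f + (m * f + p)) + suc x * p
  collect = solve-∀

-- ... hence it is expPart (x+1).
expPart-suc : ∀ x m → expPart (suc x) m ≡ binomial-sum m (expPart x)
expPart-suc x zero = refl
expPart-suc x (suc m) = trans (cong (λ z → suc m * z + suc x ^ suc m) (expPart-suc x m))
                              (sym (binomial-sum-expPart-rec x m))

expPart-zero : ∀ j → expPart 0 j ≡ j !
expPart-zero zero = refl
expPart-zero (suc j) = trans (+-identityʳ _) (cong (suc j *_) (expPart-zero j))

-- expPart x j / j! = Σ_{k≤j} x^k/k! is increasing in j.
expPart-increasing : ∀ x j d → expPart x j * (d + j) ! ≤ expPart x (d + j) * j !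
expPart-increasing x j zero = ≤-refl
expPart-increasing x j (suc d) = begin
  expPart x j * (n * (d + j) !)    ≡⟨ swap (expPart x j) n ((d + j) !) ⟩
  n * (expPart x j * (d + j) !)    ≤⟨ *-monoʳ-≤ n (expPart-increasing x j d) ⟩
  n * (expPart x (d + j) * j !)    ≡⟨ sym (*-assoc n (expPart x (d + j)) (j !)) ⟩
  n * expPart x (d + j) * j !      ≤⟨ *-monoˡ-≤ (j !) (m≤m+n (n * expPart x (d + j)) (x ^ n)) ⟩
  expPart x (suc d + j) * j !      ∎
  where
  open ≤-Reasoning
  n = suc (d + j)
  swap : ∀ a b c → a * (b * c) ≡ b * (a * c)
  swap = solve-∀

-- e ≤ 3 on partial sums: Σ_{k≤m} 1/k! ≤ 3, via the invariant Σ_{k≤m} 1/k! + 2/2^m ≤ 3.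
expPart-one : ∀ m → expPart 1 m ≤ 3 * m !
expPart-one m = *-cancelˡ-≤ (2 ^ m) {{m^n≢0 2 m}} (begin
  2 ^ m * expPart 1 m                ≤⟨ m≤m+n _ _ ⟩
  2 ^ m * expPart 1 m + 2 * m !      ≤⟨ invariant m ⟩
  3 * 2 ^ m * m !                    ≡⟨ swap (2 ^ m) (m !) ⟩
  2 ^ m * (3 * m !)                  ∎)
  where
  open ≤-Reasoning
  swap : ∀ p f → 3 * p * f ≡ p * (3 * f)
  swap = solve-∀
  regroup : ∀ p e f m → 2 * p * (suc m * e + 1) + 2 * (suc m * f) + 2 * suc m * f
                      ≡ 2 * suc m * (p * e + 2 * f) + 2 * p
  regroup = solve-∀
  collect : ∀ p f m → 2 * suc m * (3 * p * f) + 2 * (suc m * f) ≡ 3 * (2 * p) * (suc m * f) + 2 * suc m * f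
  collect = solve-∀
  invariant : ∀ m → 2 ^ m * expPart 1 m + 2 * m ! ≤ 3 * 2 ^ m * m !
  invariant zero = ≤-refl
  invariant (suc m) = +-cancelʳ-≤ (2 * suc m * m !) _ _ (begin
    2 * 2 ^ m * (suc m * e + 1 ^ suc m) + 2 * (suc m * m !) + 2 * suc m * m !
      ≡⟨ cong (λ z → 2 * 2 ^ m * (suc m * e + z) + 2 * (suc m * m !) + 2 * suc m * m !) (^-zeroˡ (suc m)) ⟩
    2 * 2 ^ m * (suc m * e + 1) + 2 * (suc m * m !) + 2 * suc m * m !
      ≡⟨ regroup (2 ^ m) e (m !) m ⟩
    2 * suc m * (2 ^ m * e + 2 * m !) + 2 * 2 ^ m
      ≤⟨ +-mono-≤ (*-monoʳ-≤ (2 * suc m) (invariant m)) (*-monoʳ-≤ 2 (2^≤factorial m)) ⟩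
    2 * suc m * (3 * 2 ^ m * m !) + 2 * (suc m * m !)
      ≡⟨ collect (2 ^ m) (m !) m ⟩
    3 * (2 * 2 ^ m) * (suc m * m !) + 2 * suc m * m ! ∎)
    where e = expPart 1 m

-- e^(x+1) ≤ 3·e^x on partial sums: by expPart-suc and the monotonicity of
-- expPart x j / j!, m!·expPart (x+1) m ≤ expPart x m · Σ_j C(m,j) j! = expPart x m · expPart 1 m.
expPart-suc≤ : ∀ x m → expPart (suc x) m ≤ 3 * expPart x m
expPart-suc≤ x m = *-cancelˡ-≤ (m !) {{m !≢0}} (begin
  m ! * expPart (suc x) m                      ≡⟨ cong (m ! *_) (expPart-suc x m) ⟩
  m ! * binomial-sum m (expPart x)             ≡⟨ sym (binomial-sum-* m (m !) (expPart x)) ⟩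
  binomial-sum m (λ j → m ! * expPart x j)     ≤⟨ binomial-sum-mono m _ _ ratio ⟩
  binomial-sum m (λ j → expPart x m * j !)     ≡⟨ binomial-sum-* m (expPart x m) _! ⟩
  expPart x m * binomial-sum m _!              ≡⟨ cong (expPart x m *_) factorials ⟩
  expPart x m * expPart 1 m                    ≤⟨ *-monoʳ-≤ (expPart x m) (expPart-one m) ⟩
  expPart x m * (3 * m !)                      ≡⟨ swap (expPart x m) (m !) ⟩
  m ! * (3 * expPart x m)                      ∎)
  where
  open ≤-Reasoning
  swap : ∀ e f → e * (3 * f) ≡ f * (3 * e)
  swap = solve-∀
  factorials : binomial-sum m _! ≡ expPart 1 m
  factorials = sym (trans (expPart-suc 0 m) (binomial-sum-cong m expPart-zero))
  ratio : ∀ j → j ≤ m → m ! * expPart x j ≤ expPart x m * j !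
  ratio j j≤m = begin
    m ! * expPart x j                   ≡⟨ *-comm (m !) (expPart x j) ⟩
    expPart x j * m !                   ≡⟨ cong (λ z → expPart x j * z !) (sym (m∸n+n≡m j≤m)) ⟩
    expPart x j * ((m ∸ j) + j) !       ≤⟨ expPart-increasing x j (m ∸ j) ⟩
    expPart x ((m ∸ j) + j) * j !       ≡⟨ cong (λ z → expPart x z * j !) (m∸n+n≡m j≤m) ⟩
    expPart x m * j !                   ∎

expPart≤3^ : ∀ B m → expPart B m ≤ 3 ^ B * m !
expPart≤3^ zero m = ≤-reflexive (trans (expPart-zero m) (sym (+-identityʳ _)))
expPart≤3^ (suc B) m = begin
  expPart (suc B) m        ≤⟨ expPart-suc≤ B m ⟩
  3 * expPart B m          ≤⟨ *-monoʳ-≤ 3 (expPart≤3^ B m) ⟩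
  3 * (3 ^ B * m !)        ≡⟨ sym (*-assoc 3 (3 ^ B) (m !)) ⟩
  3 ^ suc B * m !          ∎
  where open ≤-Reasoning

MulExpLe-from-3^ : ∀ x B y → x * 3 ^ B ≤ y → MulExpLe x B y
MulExpLe-from-3^ x B y x3^B≤y m = begin
  x * expPart B m          ≤⟨ *-monoʳ-≤ x (expPart≤3^ B m) ⟩
  x * (3 ^ B * m !)        ≡⟨ sym (*-assoc x _ _) ⟩
  x * 3 ^ B * m !          ≤⟨ *-monoˡ-≤ (m !) x3^B≤y ⟩
  y * m !                  ∎
  where open ≤-Reasoning

RefinedAt : ℕ → ℕ → ℕ → ℕ → ℕ → Set
RefinedAt r s k c i = J r s i * 3 ^ binom (i + c) k ≤ (2 * (i + 1)) ^ binom (i + c) k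

RefinedBound : ℕ → ℕ → ℕ → Set
RefinedBound r s k = ∃[ c ] Eventually (RefinedAt r s k c)

-- The two conditions that let the refined bound of order k+1 propagate through
-- the recursion at index i+1.  With w = 2(i+2): the term 2·J(s+2) costs at most
-- a quarter of the target, and the factor J(s+1) + 2 at most three quarters of
-- the growth w^(C(i+1+c,k+1)) / (2(i+1))^(C(i+c,k+1)) of the target.
SideV : ℕ → ℕ → ℕ → ℕ → ℕ → Set
SideV r s k c i = 8 * J r s (suc i) * 3 ^ binom (suc i + c) (suc k)
                  ≤ (2 * (suc i + 1)) ^ binom (suc i + c) (suc k)

SideF : ℕ → ℕ → ℕ → ℕ → ℕ → Set
SideF r s k c i = 4 * (2 * (i + 1)) ^ binom (i + c) (suc k) * (J r s (suc i) + 2) * 3 ^ binom (i + c) k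
                  ≤ 3 * (2 * (suc i + 1)) ^ (binom (i + c) (suc k) + binom (i + c) k)

ForLarge : (ℕ → ℕ → Set) → Set
ForLarge P = ∃[ c₀ ] ∃[ N ] (∀ c i → c₀ ≤ c → N ≤ i → P c i)

-- The refined bound for J (s+3) propagates from i+1 to i+2 under the side conditions,
-- using 3^C(i+2+c,k+1) = 3^C(i+1+c,k) · 3^C(i+1+c,k+1).
refined-induction : ∀ r s k c N → 1 ≤ N →
  (∀ i → N ≤ i → SideV r (2 + s) k c i) →
  (∀ i → N ≤ i → SideF r (1 + s) k c i) →
  RefinedAt r (3 + s) (suc k) c N →
  ∀ i → N ≤ i → RefinedAt r (3 + s) (suc k) c i
refined-induction r s k c N 1≤N sideV sideF base = induction-from (RefinedAt r (3 + s) (suc k) c) N base step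
  where
  step : ∀ i → N ≤ i → RefinedAt r (3 + s) (suc k) c i → RefinedAt r (3 + s) (suc k) c (suc i)
  step zero N≤0 _ = ⊥-elim (<⇒≱ 1≤N N≤0)
  step (suc i) N≤i previous = *-cancelˡ-≤ 4 (begin
    4 * (J r (3 + s) (2 + i) * 3 ^ (Δ + M))
      ≤⟨ *-monoʳ-≤ 4 (*-monoˡ-≤ (3 ^ (Δ + M)) (J-recursion r s i)) ⟩
    4 * ((2 * V + Y * (F + 2)) * 3 ^ (Δ + M))
      ≡⟨ cong (λ z → 4 * ((2 * V + Y * (F + 2)) * z)) (^-distribˡ-+-* 3 Δ M) ⟩
    4 * ((2 * V + Y * (F + 2)) * (3 ^ Δ * 3 ^ M))
      ≡⟨ split V Y F (3 ^ Δ) (3 ^ M) ⟩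
    8 * V * (3 ^ Δ * 3 ^ M) + 4 * (Y * 3 ^ M) * (F + 2) * 3 ^ Δ
      ≡⟨ cong (λ z → 8 * V * z + 4 * (Y * 3 ^ M) * (F + 2) * 3 ^ Δ) (sym (^-distribˡ-+-* 3 Δ M)) ⟩
    8 * V * 3 ^ (Δ + M) + 4 * (Y * 3 ^ M) * (F + 2) * 3 ^ Δ
      ≤⟨ +-mono-≤ (sideV (suc i) N≤i) (*-monoˡ-≤ (3 ^ Δ) (*-monoˡ-≤ (F + 2) (*-monoʳ-≤ 4 previous))) ⟩
    w ^ (Δ + M) + 4 * (2 * (suc i + 1)) ^ M * (F + 2) * 3 ^ Δ
      ≤⟨ +-monoʳ-≤ (w ^ (Δ + M)) (sideF (suc i) N≤i) ⟩
    w ^ (Δ + M) + 3 * w ^ (M + Δ)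
      ≡⟨ cong (λ z → w ^ (Δ + M) + 3 * w ^ z) (+-comm M Δ) ⟩
    w ^ (Δ + M) + 3 * w ^ (Δ + M)
      ≡⟨ collect (w ^ (Δ + M)) ⟩
    4 * w ^ (Δ + M) ∎)
    where
    open ≤-Reasoning
    Δ = binom (suc i + c) k
    M = binom (suc i + c) (suc k)
    V = J r (2 + s) (2 + i)
    F = J r (1 + s) (2 + i)
    Y = J r (3 + s) (1 + i)
    w = 2 * (suc (suc i) + 1)
    split : ∀ v y f a b → 4 * ((2 * v + y * (f + 2)) * (a * b)) ≡ 8 * v * (a * b) + 4 * (y * b) * (f + 2) * a
    split = solve-∀
    collect : ∀ x → x + 3 * x ≡ 4 * x
    collect = solve-∀

-- Given side conditions for all large shifts, the refined bound of J (s+3) holds: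
-- the shift is chosen so large that it holds at the starting index.
refined-from-sides : ∀ r s k →
  ForLarge (SideV r (2 + s) k) → ForLarge (SideF r (1 + s) k) → RefinedBound r (3 + s) (suc k)
refined-from-sides r s k (cV , NV , sideV) (cF , NF , sideF) =
  c , N , refined-induction r s k c N (s≤s z≤n)
            (λ i N≤i → sideV c i (≤-by-sum (cF + X) (sym (+-assoc cV cF X))) (≤-trans (≤-by-sum (NF + 5 + k) (arith₁ NV NF k)) N≤i))
            (λ i N≤i → sideF c i (≤-by-sum (X + cV) (arith₂ cV cF X)) (≤-trans (≤-by-sum (NV + 5 + k) (arith₃ NV NF k)) N≤i))
            base
  where
  N = suc (NV + NF + 4 + k)
  X = J r (3 + s) N
  c = cV + cF + X
  arith₁ : ∀ a b k → a + (b + 5 + k) ≡ suc (a + b + 4 + k)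
  arith₁ = solve-∀
  arith₂ : ∀ a b x → b + (x + a) ≡ a + b + x
  arith₂ = solve-∀
  arith₃ : ∀ a b k → b + (a + 5 + k) ≡ suc (a + b + 4 + k)
  arith₃ = solve-∀
  arith₄ : ∀ a b k x p q → x + k + (suc (a + b + 4) + p + q) ≡ suc (a + b + 4 + k) + (p + q + x)
  arith₄ = solve-∀
  e = binom (N + c) (suc k)
  X≤2^e : X ≤ 2 ^ e
  X≤2^e = below-2^binom X k (≤-by-sum (suc (NV + NF + 4) + cV + cF) (arith₄ NV NF k X cV cF))
  6≤w : 2 * 3 ≤ 2 * (N + 1)
  6≤w = *-monoʳ-≤ 2 {3} {N + 1} (≤-by-sum (NV + NF + 3 + k) (arith₅ NV NF k))
    where
    arith₅ : ∀ a b k → 3 + (a + b + 3 + k) ≡ suc (a + b + 4 + k) + 1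
    arith₅ = solve-∀
  base : RefinedAt r (3 + s) (suc k) c N
  base = ≤-trans (*-monoˡ-≤ (3 ^ e) X≤2^e) (^-product-bound e 6≤w)

-- A crude bound of order k+1 for J s gives the first side condition for every
-- shift c ≥ b + 3: 8·2^C(i+1+b,k+1) ≤ 2^C(i+1+c,k+1), and 2^n·3^n ≤ (2(i+2))^n.
sideV-from-crude : ∀ r s k → CrudeBound r s (suc k) → ForLarge (SideV r s k)
sideV-from-crude r s k (b , Nb , below) = b + 3 , suc (Nb + k) , sideV
  where
  sideV : ∀ c i → b + 3 ≤ c → suc (Nb + k) ≤ i → SideV r s k c i
  sideV c i b+3≤c past = begin
    8 * J r s (suc i) * 3 ^ n   ≤⟨ *-monoˡ-≤ (3 ^ n) (*-monoʳ-≤ 8 (below (suc i) Nb≤)) ⟩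
    8 * 2 ^ x * 3 ^ n           ≡⟨ cong (_* 3 ^ n) (trans (*-comm 8 (2 ^ x)) (sym (^-distribˡ-+-* 2 x 3))) ⟩
    2 ^ (x + 3) * 3 ^ n         ≤⟨ *-monoˡ-≤ (3 ^ n) (^-monoʳ-≤ 2 x+3≤n) ⟩
    2 ^ n * 3 ^ n               ≤⟨ ^-product-bound n 6≤w ⟩
    (2 * (suc i + 1)) ^ n       ∎
    where
    open ≤-Reasoning
    n = binom (suc i + c) (suc k)
    x = binom (suc i + b) (suc k)
    Nb+k≤i : Nb + k ≤ i
    Nb+k≤i = ≤-trans (n≤1+n _) past
    Nb≤ : Nb ≤ suc i
    Nb≤ = ≤-trans (m≤m+n Nb k) (≤-trans Nb+k≤i (n≤1+n i))
    x+3≤n : x + 3 ≤ n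
    x+3≤n = binom-absorbs 3 k (≤-trans (m≤n+m k Nb) (≤-trans Nb+k≤i (≤-trans (n≤1+n i) (m≤m+n (suc i) b))))
              (≤-trans (≤-reflexive (arith i b)) (+-monoʳ-≤ (suc i) b+3≤c))
      where
      arith : ∀ i b → 3 + (suc i + b) ≡ suc i + (b + 3)
      arith = solve-∀
    6≤w : 2 * 3 ≤ 2 * (suc i + 1)
    6≤w = *-monoʳ-≤ 2 {3} {suc i + 1} (≤-trans (s≤s (≤-trans (s≤s (≤-trans (s≤s z≤n) past)) (≤-reflexive (+-comm 1 i)))) ≤-refl)

-- The slack in a refined bound: if y·3^n ≤ w^n with w ≥ 12, 1 ≤ n and n + 2 ≤ Δ,
-- then 4·(y + 2)·3^Δ ≤ 3·w^Δ, because 16·3^e ≤ 4^e·3^e ≤ w^e for e = Δ − n ≥ 2.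
refined-slack : ∀ y w n Δ → 12 ≤ w → 1 ≤ n → n + 2 ≤ Δ → y * 3 ^ n ≤ w ^ n →
                4 * (y + 2) * 3 ^ Δ ≤ 3 * w ^ Δ
refined-slack y w n Δ 12≤w 1≤n n+2≤Δ bound = *-cancelˡ-≤ 4 (begin
  4 * (4 * (y + 2) * 3 ^ Δ)           ≡⟨ expand y (3 ^ Δ) ⟩
  16 * y * 3 ^ Δ + 32 * 3 ^ Δ         ≤⟨ +-mono-≤ main constant ⟩
  w ^ Δ + w ^ Δ                       ≤⟨ m≤m+n _ (10 * w ^ Δ) ⟩
  w ^ Δ + w ^ Δ + 10 * w ^ Δ          ≡⟨ collect (w ^ Δ) ⟩
  4 * (3 * w ^ Δ)                     ∎)
  where
  open ≤-Reasoning
  e = Δ ∸ n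
  e+n≡Δ : e + n ≡ Δ
  e+n≡Δ = m∸n+n≡m (≤-trans (m≤m+n n 2) n+2≤Δ)
  2≤e : 2 ≤ e
  2≤e = +-cancelʳ-≤ n 2 e (≤-trans (≤-reflexive (+-comm 2 n)) (≤-trans n+2≤Δ (≤-reflexive (sym e+n≡Δ))))
  3≤Δ : 3 ≤ Δ
  3≤Δ = ≤-trans (+-monoˡ-≤ 2 1≤n) n+2≤Δ
  expand : ∀ y a → 4 * (4 * (y + 2) * a) ≡ 16 * y * a + 32 * a
  expand = solve-∀
  collect : ∀ x → x + x + 10 * x ≡ 4 * (3 * x)
  collect = solve-∀
  regroup : ∀ y a b → 16 * y * (a * b) ≡ (16 * a) * (y * b)
  regroup = solve-∀
  main : 16 * y * 3 ^ Δ ≤ w ^ Δ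
  main = begin
    16 * y * 3 ^ Δ            ≡⟨ cong (λ z → 16 * y * 3 ^ z) (sym e+n≡Δ) ⟩
    16 * y * 3 ^ (e + n)      ≡⟨ cong (16 * y *_) (^-distribˡ-+-* 3 e n) ⟩
    16 * y * (3 ^ e * 3 ^ n)  ≡⟨ regroup y (3 ^ e) (3 ^ n) ⟩
    (16 * 3 ^ e) * (y * 3 ^ n) ≤⟨ *-mono-≤ (≤-trans (*-monoˡ-≤ (3 ^ e) (^-monoʳ-≤ 4 2≤e)) (^-product-bound e 12≤w)) bound ⟩
    w ^ e * w ^ n             ≡⟨ sym (^-distribˡ-+-* w e n) ⟩
    w ^ (e + n)               ≡⟨ cong (w ^_) e+n≡Δ ⟩
    w ^ Δ                     ∎
  constant : 32 * 3 ^ Δ ≤ w ^ Δ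
  constant = ≤-trans (*-monoˡ-≤ (3 ^ Δ) (≤-trans (m≤m+n 32 32) (^-monoʳ-≤ 4 3≤Δ))) (^-product-bound Δ 12≤w)

sideF-from-refined : ∀ r s k → RefinedBound r s (suc k) → ForLarge (SideF r s (suc k))
sideF-from-refined r s k (c' , N' , bound) = c' + 3 , N' + 4 + k , sideF
  where
  sideF : ∀ c i → c' + 3 ≤ c → N' + 4 + k ≤ i → SideF r s (suc k) c i
  sideF c i c'+3≤c past = begin
    4 * w' ^ M * (y + 2) * 3 ^ Δ    ≤⟨ *-monoˡ-≤ (3 ^ Δ) (*-monoˡ-≤ (y + 2) (*-monoʳ-≤ 4 (^-monoˡ-≤ M w'≤w))) ⟩
    4 * w ^ M * (y + 2) * 3 ^ Δ     ≡⟨ regroup (w ^ M) y (3 ^ Δ) ⟩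
    w ^ M * (4 * (y + 2) * 3 ^ Δ)   ≤⟨ *-monoʳ-≤ (w ^ M) (refined-slack y w n Δ 12≤w 1≤n n+2≤Δ (bound (suc i) N'≤)) ⟩
    w ^ M * (3 * w ^ Δ)             ≡⟨ swap (w ^ M) (w ^ Δ) ⟩
    3 * (w ^ M * w ^ Δ)             ≡⟨ cong (3 *_) (sym (^-distribˡ-+-* w M Δ)) ⟩
    3 * w ^ (M + Δ)                 ∎
    where
    open ≤-Reasoning
    M = binom (i + c) (suc (suc k))
    Δ = binom (i + c) (suc k)
    n = binom (suc i + c') (suc k)
    w = 2 * (suc i + 1)
    w' = 2 * (i + 1)
    y = J r s (suc i)
    regroup : ∀ a y b → 4 * a * (y + 2) * b ≡ a * (4 * (y + 2) * b)
    regroup = solve-∀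
    swap : ∀ a b → a * (3 * b) ≡ 3 * (a * b)
    swap = solve-∀
    w'≤w : w' ≤ w
    w'≤w = *-monoʳ-≤ 2 (n≤1+n (i + 1))
    N'≤ : N' ≤ suc i
    N'≤ = ≤-trans (≤-trans (m≤m+n N' 4) (m≤m+n (N' + 4) k)) (≤-trans past (n≤1+n i))
    k≤i : k ≤ i
    k≤i = ≤-trans (m≤n+m k (N' + 4)) past
    12≤w : 12 ≤ w
    12≤w = *-monoʳ-≤ 2 {6} {suc i + 1} (≤-trans (≤-trans (s≤s (s≤s (≤-trans (m≤n+m 4 N') (≤-trans (m≤m+n (N' + 4) k) past))))
                                          (≤-reflexive (cong suc (+-comm 1 i)))) ≤-refl)
    1≤n : 1 ≤ n
    1≤n = binom-pos (suc i + c') (suc k) (s≤s (≤-trans k≤i (m≤m+n i c')))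
    n+2≤Δ : n + 2 ≤ Δ
    n+2≤Δ = binom-absorbs 2 k (≤-trans k≤i (≤-trans (n≤1+n i) (m≤m+n (suc i) c')))
              (≤-trans (≤-reflexive (arith i c')) (+-monoʳ-≤ i c'+3≤c))
      where
      arith : ∀ i c → 2 + (suc i + c) ≡ i + (c + 3)
      arith = solve-∀

-- The first three terms of the binomial expansion of (k+1)^n, multiplied by k²:
-- k²·(k^n + n·k^(n−1) + C(n,2)·k^(n−2)) ≤ k²·(k+1)^n.
binomial-three-terms : ∀ k n → k * (k * k ^ n) + n * (k * k ^ n) + binom n 2 * k ^ n ≤ k * k * suc k ^ n
binomial-three-terms k zero = ≤-reflexive (normalise k)
  where
  normalise : ∀ k → k * (k * 1) + 0 * (k * 1) + 0 * 1 ≡ k * k * 1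
  normalise = solve-∀
binomial-three-terms k (suc n) = begin
  k * (k * (k * p)) + suc n * (k * (k * p)) + (binom n 1 + binom n 2) * (k * p)
    ≡⟨ cong (λ z → k * (k * (k * p)) + suc n * (k * (k * p)) + (z + binom n 2) * (k * p)) (binom-1 n) ⟩
  k * (k * (k * p)) + suc n * (k * (k * p)) + (n + binom n 2) * (k * p)
    ≤⟨ m≤m+n _ (binom n 2 * p) ⟩
  k * (k * (k * p)) + suc n * (k * (k * p)) + (n + binom n 2) * (k * p) + binom n 2 * p
    ≡⟨ factor k n (binom n 2) p ⟩
  suc k * (k * (k * p) + n * (k * p) + binom n 2 * p)
    ≤⟨ *-monoʳ-≤ (suc k) (binomial-three-terms k n) ⟩
  suc k * (k * k * suc k ^ n)
    ≡⟨ swap k (suc k ^ n) ⟩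
  k * k * suc k ^ suc n ∎
  where
  open ≤-Reasoning
  p = k ^ n
  factor : ∀ k n b p → k * (k * (k * p)) + suc n * (k * (k * p)) + (n + b) * (k * p) + b * p
                     ≡ suc k * (k * (k * p) + n * (k * p) + b * p)
  factor = solve-∀
  swap : ∀ k q → suc k * (k * k * q) ≡ k * k * (suc k * q)
  swap = solve-∀

-- (1 + 1/k)^k ≥ 9/4 for k ≥ 2, from the first three binomial terms 1 + 1 + (k−1)/(2k).
nine-quarters : ∀ k → 2 ≤ k → 9 * k ^ k ≤ 4 * suc k ^ k
nine-quarters (suc (suc m)) (s≤s (s≤s z≤n)) = *-cancelˡ-≤ (k * k) (begin
  k * k * (9 * p)                         ≡⟨ split (k * k) p ⟩
  8 * (k * k * p) + k * k * p             ≤⟨ +-monoʳ-≤ (8 * (k * k * p)) (*-monoˡ-≤ p k²≤4b) ⟩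
  8 * (k * k * p) + 4 * b * p             ≡⟨ regroup k b p ⟩
  4 * (k * (k * p) + k * (k * p) + b * p) ≤⟨ *-monoʳ-≤ 4 (binomial-three-terms k k) ⟩
  4 * (k * k * suc k ^ k)                 ≡⟨ swap (k * k) (suc k ^ k) ⟩
  k * k * (4 * suc k ^ k)                 ∎)
  where
  open ≤-Reasoning
  k = suc (suc m)
  p = k ^ k
  b = binom k 2
  split : ∀ x p → x * (9 * p) ≡ 8 * (x * p) + x * p
  split = solve-∀
  regroup : ∀ k b p → 8 * (k * k * p) + 4 * b * p ≡ 4 * (k * (k * p) + k * (k * p) + b * p)
  regroup = solve-∀
  swap : ∀ x y → 4 * (x * y) ≡ x * (4 * y)
  swap = solve-∀
  double : ∀ b k → (2 * b + k) + (2 * b + k) ≡ 4 * b + 2 * k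
  double = solve-∀
  k²≤4b : k * k ≤ 4 * b
  k²≤4b = +-cancelʳ-≤ (2 * k) (k * k) (4 * b) (begin
    k * k + 2 * k              ≤⟨ +-monoʳ-≤ (k * k) (*-monoˡ-≤ k (s≤s (s≤s (z≤n {m})))) ⟩
    k * k + k * k              ≡⟨ cong (λ z → z + z) (sym (binom-2 k)) ⟩
    (2 * b + k) + (2 * b + k)  ≡⟨ double b k ⟩
    4 * b + 2 * k              ∎)

factorial-vs-power : ∀ n → (suc n) ! * 2 * 9 ^ n ≤ suc (suc n) ^ (suc n) * 4 ^ n
factorial-vs-power zero = ≤-refl
factorial-vs-power (suc n) = begin
  (a * (suc n) !) * 2 * (9 * 9 ^ n)  ≡⟨ regroup a ((suc n) !) (9 ^ n) ⟩
  9 * (a * ((suc n) ! * 2 * 9 ^ n))  ≤⟨ *-monoʳ-≤ 9 (*-monoʳ-≤ a (factorial-vs-power n)) ⟩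
  9 * (a * (a ^ suc n * 4 ^ n))      ≡⟨ regroup′ (a ^ suc n) a (4 ^ n) ⟩
  (9 * a ^ a) * 4 ^ n                ≤⟨ *-monoˡ-≤ (4 ^ n) (nine-quarters a (s≤s (s≤s z≤n))) ⟩
  (4 * suc a ^ a) * 4 ^ n            ≡⟨ swap (suc a ^ a) (4 ^ n) ⟩
  suc a ^ a * (4 * 4 ^ n)            ∎
  where
  open ≤-Reasoning
  a = suc (suc n)
  regroup : ∀ a f q → (a * f) * 2 * (9 * q) ≡ 9 * (a * (f * 2 * q))
  regroup = solve-∀
  regroup′ : ∀ x a q → 9 * (a * (x * q)) ≡ (9 * (a * x)) * q
  regroup′ = solve-∀
  swap : ∀ x q → (4 * x) * q ≡ x * (4 * q)
  swap = solve-∀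

-- 4^i · 4^⌊i/2⌋ ≤ 2 · 3^i · 9^⌊i/2⌋ (both sides grow by 64 ≤ 81 every two steps).
four-vs-three-nine : ∀ i → 4 ^ i * 4 ^ ⌊ i /2⌋ ≤ 2 * (3 ^ i * 9 ^ ⌊ i /2⌋)
four-vs-three-nine zero = s≤s z≤n
four-vs-three-nine (suc zero) = s≤s (s≤s (s≤s (s≤s z≤n)))
four-vs-three-nine (suc (suc i)) = begin
  (4 * (4 * 4 ^ i)) * (4 * 4 ^ L)     ≡⟨ sixty-four (4 ^ i) (4 ^ L) ⟩
  64 * (4 ^ i * 4 ^ L)                ≤⟨ *-monoʳ-≤ 64 (four-vs-three-nine i) ⟩
  64 * (2 * (3 ^ i * 9 ^ L))          ≤⟨ *-monoˡ-≤ (2 * (3 ^ i * 9 ^ L)) (m≤m+n 64 17) ⟩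
  81 * (2 * (3 ^ i * 9 ^ L))          ≡⟨ eighty-one (3 ^ i) (9 ^ L) ⟩
  2 * ((3 * (3 * 3 ^ i)) * (9 * 9 ^ L)) ∎
  where
  open ≤-Reasoning
  L = ⌊ i /2⌋
  sixty-four : ∀ a b → (4 * (4 * a)) * (4 * b) ≡ 64 * (a * b)
  sixty-four = solve-∀
  eighty-one : ∀ a b → 81 * (2 * (a * b)) ≡ 2 * ((3 * (3 * a)) * (9 * b))
  eighty-one = solve-∀

-- Raising the base from 2j to 2(j+1) gains a factor (9/4)^L when j·L ≤ M:
-- (2j)^M · 9^L ≤ (2(j+1))^M · 4^L for j ≥ 2, since (1 + 1/j)^(jL) ≥ (9/4)^L.
base-increment : ∀ j L M → 2 ≤ j → j * L ≤ M → (2 * j) ^ M * 9 ^ L ≤ (2 * suc j) ^ M * 4 ^ L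
base-increment j L M 2≤j jL≤M = begin
  (2 * j) ^ M * 9 ^ L                   ≡⟨ cong (_* 9 ^ L) (^-distribʳ-* 2 j M) ⟩
  2 ^ M * j ^ M * 9 ^ L                 ≡⟨ *-assoc (2 ^ M) _ _ ⟩
  2 ^ M * (j ^ M * 9 ^ L)               ≤⟨ *-monoʳ-≤ (2 ^ M) without-two ⟩
  2 ^ M * (suc j ^ M * 4 ^ L)           ≡⟨ sym (*-assoc (2 ^ M) _ _) ⟩
  2 ^ M * suc j ^ M * 4 ^ L             ≡⟨ cong (_* 4 ^ L) (sym (^-distribʳ-* 2 (suc j) M)) ⟩
  (2 * suc j) ^ M * 4 ^ L               ∎
  where
  open ≤-Reasoning
  R = M ∸ j * L
  M≡ : j * L + R ≡ M
  M≡ = m+[n∸m]≡n jL≤M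
  power-split : ∀ a → a ^ M ≡ (a ^ j) ^ L * a ^ R
  power-split a = trans (cong (a ^_) (sym M≡))
                        (trans (^-distribˡ-+-* a (j * L) R) (cong (_* a ^ R) (sym (^-*-assoc a j L))))
  regroup : ∀ a b c → a * b * c ≡ (c * a) * b
  regroup = solve-∀
  regroup′ : ∀ a b c → (a * b) * c ≡ b * c * a
  regroup′ = solve-∀
  without-two : j ^ M * 9 ^ L ≤ suc j ^ M * 4 ^ L
  without-two = begin
    j ^ M * 9 ^ L                          ≡⟨ cong (_* 9 ^ L) (power-split j) ⟩
    (j ^ j) ^ L * j ^ R * 9 ^ L            ≡⟨ regroup ((j ^ j) ^ L) (j ^ R) (9 ^ L) ⟩
    (9 ^ L * (j ^ j) ^ L) * j ^ R          ≡⟨ cong (_* j ^ R) (sym (^-distribʳ-* 9 (j ^ j) L)) ⟩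
    (9 * j ^ j) ^ L * j ^ R                ≤⟨ *-mono-≤ (^-monoˡ-≤ L (nine-quarters j 2≤j)) (^-monoˡ-≤ R (n≤1+n j)) ⟩
    (4 * suc j ^ j) ^ L * suc j ^ R        ≡⟨ cong (_* suc j ^ R) (^-distribʳ-* 4 (suc j ^ j) L) ⟩
    (4 ^ L * (suc j ^ j) ^ L) * suc j ^ R  ≡⟨ regroup′ (4 ^ L) ((suc j ^ j) ^ L) (suc j ^ R) ⟩
    (suc j ^ j) ^ L * suc j ^ R * 4 ^ L    ≡⟨ cong (_* 4 ^ L) (sym (power-split (suc j))) ⟩
    suc j ^ M * 4 ^ L                      ∎

-- (i+1)·⌊i/2⌋ ≤ C(i+c,2) for c ≥ 2, as 2·C(i+2,2) = (i+1)(i+2).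
half-binom-bound : ∀ i c → 2 ≤ c → suc i * ⌊ i /2⌋ ≤ binom (i + c) 2
half-binom-bound i c 2≤c = ≤-trans j*L≤ (binom-monoˡ 2 (≤-trans (≤-reflexive (+-comm 2 i)) (+-monoʳ-≤ i 2≤c)))
  where
  L = ⌊ i /2⌋
  j = suc i
  v = suc j
  2L≤i : L + L ≤ i
  2L≤i = ≤-trans (+-monoʳ-≤ L (⌊n/2⌋≤⌈n/2⌉ i)) (≤-reflexive (⌊n/2⌋+⌈n/2⌉≡n i))
  twice-binom : 2 * binom v 2 ≡ j * v
  twice-binom = +-cancelʳ-≡ v _ _ (trans (binom-2 v) (expand j))
    where
    expand : ∀ j → suc j * suc j ≡ j * suc j + suc j
    expand = solve-∀
  double : ∀ j L → 2 * (j * L) ≡ j * (L + L)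
  double = solve-∀
  j*L≤ : j * L ≤ binom v 2
  j*L≤ = *-cancelˡ-≤ 2 (begin
    2 * (j * L)     ≡⟨ double j L ⟩
    j * (L + L)     ≤⟨ *-monoʳ-≤ j (≤-trans 2L≤i (≤-trans (n≤1+n i) (n≤1+n (suc i)))) ⟩
    j * v           ≡⟨ sym twice-binom ⟩
    2 * binom v 2   ∎)
    where open ≤-Reasoning

j5-square-const : ℕ → ℕ
j5-square-const r = 12 * j5-const r + 2

-- J 5 i + 2 ≤ j5-square-const · i² · 2^i · (i+1)!, using (i+3)! ≤ 12·i²·(i+1)!.
J5-square-upper : ∀ r j → J r 5 (suc j) + 2 ≤ j5-square-const r * (suc j * suc j) * 2 ^ suc j * (suc (suc j)) !
J5-square-upper r j = begin
  J r 5 m + 2                    ≤⟨ +-monoˡ-≤ 2 (J5-upper r j) ⟩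
  κ * q * (4 + j) ! + 2          ≤⟨ +-mono-≤ (*-monoʳ-≤ (κ * q) factorial≤) (*-monoʳ-≤ 2 1≤S) ⟩
  κ * q * (12 * (m * m) * F) + 2 * S ≡⟨ collect κ (m * m) q F ⟩
  j5-square-const r * (m * m) * q * F ∎
  where
  open ≤-Reasoning
  κ = j5-const r
  m = suc j
  q = 2 ^ m
  F = (suc m) !
  S = (m * m) * q * F
  1≤S : 1 ≤ S
  1≤S = *-mono-≤ (*-mono-≤ (s≤s (z≤n {j + j * suc j})) (m^n>0 2 m)) (1≤n! (suc m))
  factorial≤ : (4 + j) ! ≤ 12 * (m * m) * F
  factorial≤ = begin
    (4 + j) * ((3 + j) * F)  ≡⟨ sym (*-assoc (4 + j) (3 + j) F) ⟩
    (4 + j) * (3 + j) * F    ≤⟨ *-monoˡ-≤ F (*-mono-≤ (≤-by-sum {4 + j} (3 * j) (four j)) (≤-by-sum {3 + j} (2 * j) (three j))) ⟩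
    (4 * m) * (3 * m) * F    ≡⟨ twelve m F ⟩
    12 * (m * m) * F         ∎
    where
    four : ∀ j → 4 + j + 3 * j ≡ 4 * suc j
    four = solve-∀
    three : ∀ j → 3 + j + 2 * j ≡ 3 * suc j
    three = solve-∀
    twelve : ∀ m F → (4 * m) * (3 * m) * F ≡ 12 * (m * m) * F
    twelve = solve-∀
  collect : ∀ κ x q F → κ * q * (12 * x * F) + 2 * (x * q * F) ≡ (12 * κ + 2) * x * q * F
  collect = solve-∀

-- The factorial and the powers 4^⌊i/2⌋ are traded for powers of (i+2), 3 and 9,
-- by factorial-vs-power and four-vs-three-nine (here j = i+1, v = i+2, Δ = i+4+f).
sideF-J5-factorials : ∀ B i f →
  4 * (B * (suc i * suc i) * 2 ^ suc i * (suc (suc i)) !) * 3 ^ (i + (4 + f)) * 4 ^ ⌊ i /2⌋ * (2 * 9 ^ i)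
  ≤ 2 * 9 ^ i * (81 * 3 ^ f * (4 * B * (suc i * suc i) * 2 ^ suc i * suc (suc i)) * suc (suc i) ^ suc i * 9 ^ ⌊ i /2⌋)
sideF-J5-factorials B i f = begin
  4 * (B * (j * j) * 2 ^ j * (v * j !)) * 3 ^ (i + (4 + f)) * 4 ^ L * (2 * 9 ^ i)
    ≡⟨ cong (λ z → 4 * (B * (j * j) * 2 ^ j * (v * j !)) * z * 4 ^ L * (2 * 9 ^ i)) (^-distribˡ-+-* 3 i (4 + f)) ⟩
  4 * (B * (j * j) * 2 ^ j * (v * j !)) * (3 ^ i * 3 ^ (4 + f)) * 4 ^ L * (2 * 9 ^ i)
    ≡⟨ regroup₁ B (j * j) (2 ^ j) v (j !) (3 ^ i) (3 ^ f) (4 ^ L) (9 ^ i) ⟩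
  P * 3 ^ i * (81 * 3 ^ f) * 4 ^ L * (j ! * 2 * 9 ^ i)
    ≤⟨ *-monoʳ-≤ (P * 3 ^ i * (81 * 3 ^ f) * 4 ^ L) (factorial-vs-power i) ⟩
  P * 3 ^ i * (81 * 3 ^ f) * 4 ^ L * (v ^ j * 4 ^ i)
    ≡⟨ regroup₂ P (3 ^ i) (3 ^ f) (4 ^ L) (v ^ j) (4 ^ i) ⟩
  P * 3 ^ i * (81 * 3 ^ f) * v ^ j * (4 ^ i * 4 ^ L)
    ≤⟨ *-monoʳ-≤ (P * 3 ^ i * (81 * 3 ^ f) * v ^ j) (four-vs-three-nine i) ⟩
  P * 3 ^ i * (81 * 3 ^ f) * v ^ j * (2 * (3 ^ i * 9 ^ L))
    ≡⟨ regroup₃ P (3 ^ i) (3 ^ f) (v ^ j) (9 ^ L) ⟩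
  2 * (3 ^ i * 3 ^ i) * (81 * 3 ^ f * P * v ^ j * 9 ^ L)
    ≡⟨ cong (λ z → 2 * z * (81 * 3 ^ f * P * v ^ j * 9 ^ L)) (sym (^-distribʳ-* 3 3 i)) ⟩
  2 * 9 ^ i * (81 * 3 ^ f * P * v ^ j * 9 ^ L) ∎
  where
  open ≤-Reasoning
  j = suc i
  v = suc j
  L = ⌊ i /2⌋
  P = 4 * B * (j * j) * 2 ^ j * v
  regroup₁ : ∀ b x p v f a t l n → 4 * (b * x * p * (v * f)) * (a * (3 * (3 * (3 * (3 * t))))) * l * (2 * n)
                                 ≡ 4 * b * x * p * v * a * (81 * t) * l * (f * 2 * n)
  regroup₁ = solve-∀
  regroup₂ : ∀ P a t l y z → P * a * (81 * t) * l * (y * z) ≡ P * a * (81 * t) * y * (z * l)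
  regroup₂ = solve-∀
  regroup₃ : ∀ P a t y n → P * a * (81 * t) * y * (2 * (a * n)) ≡ 2 * (a * a) * (81 * t * P * y * n)
  regroup₃ = solve-∀

-- The remaining polynomial and exponential factors fit into 3·(2(i+2))^(i+4+f)
-- once 14·B ≤ 2^f, since 81·B·j²·3^f ≤ 6·2^f·v²·v^f.
sideF-J5-powers : ∀ B i f → 1 ≤ i → 14 * B ≤ 2 ^ f →
  81 * 3 ^ f * (4 * B * (suc i * suc i) * 2 ^ suc i * suc (suc i)) * suc (suc i) ^ suc i
  ≤ 3 * (2 * suc (suc i)) ^ (i + (4 + f))
sideF-J5-powers B i f 1≤i 14B≤2^f = begin
  81 * 3 ^ f * (4 * B * (j * j) * (2 * 2 ^ i) * v) * v ^ j
    ≡⟨ regroup₁ B (j * j) (3 ^ f) (2 ^ i) v (v ^ j) ⟩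
  (81 * B * (j * j) * 3 ^ f) * (8 * 2 ^ i * v * v ^ j)
    ≤⟨ *-monoˡ-≤ (8 * 2 ^ i * v * v ^ j) constant ⟩
  (6 * 2 ^ f * (v * v) * v ^ f) * (8 * 2 ^ i * v * v ^ j)
    ≡⟨ regroup₂ (2 ^ f) v (v ^ f) (2 ^ i) (v ^ j) ⟩
  3 * ((2 ^ i * (2 * (2 * (2 * (2 * 2 ^ f))))) * (v ^ j * (v * (v * (v * v ^ f)))))
    ≡⟨ cong (3 *_) (sym powers) ⟩
  3 * (2 * v) ^ (i + (4 + f)) ∎
  where
  open ≤-Reasoning
  j = suc i
  v = suc j
  regroup₁ : ∀ b x t p v y → 81 * t * (4 * b * x * (2 * p) * v) * y ≡ (81 * b * x * t) * (8 * p * v * y)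
  regroup₁ = solve-∀
  regroup₂ : ∀ t v s p y → (6 * t * (v * v) * s) * (8 * p * v * y)
                         ≡ 3 * ((p * (2 * (2 * (2 * (2 * t))))) * (y * (v * (v * (v * s)))))
  regroup₂ = solve-∀
  powers : (2 * v) ^ (i + (4 + f)) ≡ (2 ^ i * (2 * (2 * (2 * (2 * 2 ^ f))))) * (v ^ j * (v * (v * (v * v ^ f))))
  powers = trans (^-distribʳ-* 2 v (i + (4 + f)))
                 (cong₂ _*_ (^-distribˡ-+-* 2 i (4 + f)) (trans (cong (v ^_) (+-suc i (3 + f))) (^-distribˡ-+-* v j (3 + f))))
  eighty-four : ∀ b x t → 84 * b * x * t ≡ 6 * (14 * b) * x * t
  eighty-four = solve-∀
  constant : 81 * B * (j * j) * 3 ^ f ≤ 6 * 2 ^ f * (v * v) * v ^ f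
  constant = begin
    81 * B * (j * j) * 3 ^ f    ≤⟨ *-mono-≤ (*-mono-≤ (*-monoˡ-≤ B (m≤m+n 81 3)) (*-mono-≤ (n≤1+n j) (n≤1+n j))) (^-monoˡ-≤ f (s≤s (s≤s 1≤i))) ⟩
    84 * B * (v * v) * v ^ f    ≡⟨ eighty-four B (v * v) (v ^ f) ⟩
    6 * (14 * B) * (v * v) * v ^ f ≤⟨ *-monoˡ-≤ (v ^ f) (*-monoˡ-≤ (v * v) (*-monoʳ-≤ 6 14B≤2^f)) ⟩
    6 * 2 ^ f * (v * v) * v ^ f ∎

sideF-J5-core : ∀ B i f → 1 ≤ i → 14 * B ≤ 2 ^ f →
  4 * (B * (suc i * suc i) * 2 ^ suc i * (suc (suc i)) !) * 3 ^ (i + (4 + f)) * 4 ^ ⌊ i /2⌋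
  ≤ 3 * (2 * suc (suc i)) ^ (i + (4 + f)) * 9 ^ ⌊ i /2⌋
sideF-J5-core B i f 1≤i 14B≤2^f = *-cancelʳ-≤ _ _ (2 * 9 ^ i) {{nonzero}} (begin
  4 * (B * (j * j) * 2 ^ j * (suc j) !) * 3 ^ Δ * 4 ^ L * (2 * 9 ^ i)
    ≤⟨ sideF-J5-factorials B i f ⟩
  2 * 9 ^ i * (81 * 3 ^ f * (4 * B * (j * j) * 2 ^ j * v) * v ^ j * 9 ^ L)
    ≤⟨ *-monoʳ-≤ (2 * 9 ^ i) (*-monoˡ-≤ (9 ^ L) (sideF-J5-powers B i f 1≤i 14B≤2^f)) ⟩
  2 * 9 ^ i * (3 * (2 * v) ^ Δ * 9 ^ L)
    ≡⟨ *-comm (2 * 9 ^ i) _ ⟩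
  3 * (2 * v) ^ Δ * 9 ^ L * (2 * 9 ^ i) ∎)
  where
  open ≤-Reasoning
  j = suc i
  v = suc j
  L = ⌊ i /2⌋
  Δ = i + (4 + f)
  nonzero : NonZero (2 * 9 ^ i)
  nonzero = >-nonZero (*-mono-≤ (s≤s (z≤n {1})) (m^n>0 9 i))

-- Besides the factorial bound for J 5 it uses the growth of the base from
-- 2(i+1) to 2(i+2) in the exponent C(i+4+f,2) ≥ (i+1)⌊i/2⌋ (base-increment).
sideF-J5-at : ∀ r f → 14 * j5-square-const r ≤ 2 ^ f → ∀ i → 1 ≤ i → SideF r 5 1 (4 + f) i
sideF-J5-at r f 14B≤2^f i 1≤i = begin
  4 * (2 * (i + 1)) ^ M * (J r 5 (suc i) + 2) * 3 ^ binom (i + (4 + f)) 1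
    ≡⟨ cong₂ (λ a b → 4 * (2 * a) ^ M * (J r 5 (suc i) + 2) * 3 ^ b) (+-comm i 1) (binom-1 (i + (4 + f))) ⟩
  4 * (2 * j) ^ M * (J r 5 (suc i) + 2) * 3 ^ Δ
    ≤⟨ *-monoˡ-≤ (3 ^ Δ) (*-monoʳ-≤ (4 * (2 * j) ^ M) (J5-square-upper r i)) ⟩
  4 * (2 * j) ^ M * Y * 3 ^ Δ
    ≡⟨ regroup ((2 * j) ^ M) Y (3 ^ Δ) ⟩
  Z * (2 * j) ^ M
    ≤⟨ main ⟩
  3 * (2 * v) ^ (M + Δ)
    ≡⟨ cong₂ (λ a b → 3 * (2 * a) ^ (M + b)) (cong suc (+-comm 1 i)) (sym (binom-1 (i + (4 + f)))) ⟩
  3 * (2 * (suc i + 1)) ^ (M + binom (i + (4 + f)) 1) ∎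
  where
  open ≤-Reasoning
  B = j5-square-const r
  j = suc i
  v = suc j
  L = ⌊ i /2⌋
  M = binom (i + (4 + f)) 2
  Δ = i + (4 + f)
  Y = B * (j * j) * 2 ^ j * (suc j) !
  Z = 4 * Y * 3 ^ Δ
  regroup : ∀ a y b → 4 * a * y * b ≡ (4 * y * b) * a
  regroup = solve-∀
  regroup′ : ∀ x a b → x * (a * b) ≡ (x * b) * a
  regroup′ = solve-∀
  regroup″ : ∀ a l b → (3 * a * l) * b ≡ 3 * (b * a) * l
  regroup″ = solve-∀
  main : Z * (2 * j) ^ M ≤ 3 * (2 * v) ^ (M + Δ)
  main = *-cancelʳ-≤ _ _ (9 ^ L) {{m^n≢0 9 L}} (begin
    Z * (2 * j) ^ M * 9 ^ L             ≡⟨ *-assoc Z _ _ ⟩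
    Z * ((2 * j) ^ M * 9 ^ L)           ≤⟨ *-monoʳ-≤ Z (base-increment j L M (s≤s 1≤i) (half-binom-bound i (4 + f) (s≤s (s≤s z≤n)))) ⟩
    Z * ((2 * v) ^ M * 4 ^ L)           ≡⟨ regroup′ Z ((2 * v) ^ M) (4 ^ L) ⟩
    (Z * 4 ^ L) * (2 * v) ^ M           ≤⟨ *-monoˡ-≤ ((2 * v) ^ M) (sideF-J5-core B i f 1≤i 14B≤2^f) ⟩
    (3 * (2 * v) ^ Δ * 9 ^ L) * (2 * v) ^ M ≡⟨ regroup″ ((2 * v) ^ Δ) (9 ^ L) ((2 * v) ^ M) ⟩
    3 * ((2 * v) ^ M * (2 * v) ^ Δ) * 9 ^ L ≡⟨ cong (λ z → 3 * z * 9 ^ L) (sym (^-distribˡ-+-* (2 * v) M Δ)) ⟩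
    3 * (2 * v) ^ (M + Δ) * 9 ^ L       ∎)

sideF-J5 : ∀ r → ForLarge (SideF r 5 1)
sideF-J5 r = 4 + 14 * B , 1 , sideF
  where
  B = j5-square-const r
  sideF : ∀ c i → 4 + 14 * B ≤ c → 1 ≤ i → SideF r 5 1 c i
  sideF c i c₀≤c 1≤i = subst (λ c → SideF r 5 1 c i) (m+[n∸m]≡n 4≤c)
                             (sideF-J5-at r (c ∸ 4) 14B≤2^f i 1≤i)
    where
    4≤c : 4 ≤ c
    4≤c = ≤-trans (m≤m+n 4 (14 * B)) c₀≤c
    14B≤2^f : 14 * B ≤ 2 ^ (c ∸ 4)
    14B≤2^f = ≤-trans (≤-trans (≤-reflexive (sym (m+n∸m≡n 4 (14 * B)))) (∸-monoˡ-≤ 4 c₀≤c)) (<⇒≤ (n<2^n (c ∸ 4)))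

refined : ∀ r u → RefinedBound r (7 + u * 2) (2 + u)
refined r zero = refined-from-sides r 4 1 (sideV-from-crude r 6 1 (proj₁ (crude r 1))) (sideF-J5 r)
refined r (suc u) = refined-from-sides r (6 + u * 2) (2 + u)
                      (sideV-from-crude r (8 + u * 2) (2 + u) (proj₁ (crude r (2 + u))))
                      (sideF-from-refined r (7 + u * 2) (suc u) (refined r u))

J5-factorial : ∀ r → ∃[ c ] Eventually (λ i → J r 5 i ≤ 2 ^ i * (i + c) !)
J5-factorial r = κ + 4 , 1 , below
  where
  κ = j5-const r
  below : ∀ i → 1 ≤ i → J r 5 i ≤ 2 ^ i * (i + (κ + 4)) !
  below (suc j) _ = begin
    J r 5 (suc j)                       ≤⟨ J5-upper r j ⟩
    κ * 2 ^ suc j * (4 + j) !           ≡⟨ swap κ (2 ^ suc j) ((4 + j) !) ⟩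
    2 ^ suc j * ((4 + j) ! * κ)         ≤⟨ *-monoʳ-≤ (2 ^ suc j) (*-monoʳ-≤ ((4 + j) !) (n≤1+n κ)) ⟩
    2 ^ suc j * ((4 + j) ! * suc κ)     ≤⟨ *-monoʳ-≤ (2 ^ suc j) (factorial-absorbs κ (4 + j)) ⟩
    2 ^ suc j * (suc κ + (4 + j)) !     ≡⟨ cong (λ z → 2 ^ suc j * z !) (arith κ j) ⟩
    2 ^ suc j * (suc j + (κ + 4)) !     ∎
    where
    open ≤-Reasoning
    swap : ∀ h p f → h * p * f ≡ p * (f * h)
    swap = solve-∀
    arith : ∀ h j → suc h + (4 + j) ≡ suc j + (h + 4)
    arith = solve-∀

below-J : ∀ r s (f : ℕ → ℕ) → (∀ i → f i ≤ J r s i) → (g : ℕ → ℕ → ℕ) →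
          ∃[ c ] Eventually (λ i → J r s i ≤ g c i) → ∃[ c ] Eventually (λ i → f i ≤ g c i)
below-J r s f f≤J g (c , N , below) = c , N , λ i N≤i → ≤-trans (f≤J i) (below i N≤i)

EvenBound : ℕ → ℕ → ℕ → Set
EvenBound r s t = ∃[ c ] Eventually (λ i → K s i ≤ 2 ^ ((i + c) C t) × Kdbl r s i ≤ 2 ^ ((i + c) C t))

OddBound : ℕ → ℕ → ℕ → Set
OddBound r s t = ∃[ c ] Eventually (λ i →
    MulExpLe (K s i) ((i + c) C t) ((2 * (i + 1)) ^ ((i + c) C t))
  × MulExpLe (Kdbl r s i) ((i + c) C t) ((2 * (i + 1)) ^ ((i + c) C t)))

even-bound : ∀ r u → EvenBound r (6 + u * 2) (2 + u)
even-bound r u with proj₁ (crude r (suc u))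
... | c , N , below = c , N , λ i N≤i → bound (K≤J r (6 + u * 2) i) N≤i , bound (Kdbl≤J r (6 + u * 2) i) N≤i
  where
  bound : ∀ {x i} → x ≤ J r (6 + u * 2) i → N ≤ i → x ≤ 2 ^ ((i + c) C (2 + u))
  bound {i = i} x≤J N≤i = ≤-trans x≤J (≤-trans (below i N≤i) (≤-reflexive (cong (2 ^_) (binom≡C (i + c) (2 + u)))))

-- The odd case for s = 7 + 2u, from the refined bound for J (7 + 2u) and e^B ≤ 3^B.
odd-bound : ∀ r u → OddBound r (7 + u * 2) (2 + u)
odd-bound r u with refined r u
... | c , N , below = c , N , λ i N≤i → bound (K≤J r (7 + u * 2) i) N≤i , bound (Kdbl≤J r (7 + u * 2) i) N≤i
  where
  bound : ∀ {x i} → x ≤ J r (7 + u * 2) i → N ≤ i → MulExpLe x ((i + c) C (2 + u)) ((2 * (i + 1)) ^ ((i + c) C (2 + u)))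
  bound {x} {i} x≤J N≤i = subst (λ n → MulExpLe x n ((2 * (i + 1)) ^ n)) (binom≡C (i + c) (2 + u))
    (MulExpLe-from-3^ x _ _ (≤-trans (*-monoˡ-≤ (3 ^ binom (i + c) (2 + u)) x≤J) (below i N≤i)))

even-or-odd : ∀ s → (∃[ q ] s ≡ q * 2) ⊎ (∃[ q ] s ≡ 1 + q * 2)
even-or-odd zero = inj₁ (0 , refl)
even-or-odd (suc s) with even-or-odd s
... | inj₁ (q , s≡2q) = inj₂ (q , cong suc s≡2q)
... | inj₂ (q , s≡2q+1) = inj₁ (suc q , cong suc s≡2q+1)

half-of-odd : ∀ q → (1 + q * 2) / 2 ≡ q
half-of-odd q = trans (+-distrib-/ 1 (q * 2) remainders) (m*n/n≡m q 2)
  where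
  remainders : 1 % 2 + (q * 2) % 2 < 2
  remainders = ≤-trans (≤-reflexive (cong (λ z → suc (1 + z)) (m*n%n≡0 q 2))) ≤-refl

even-case : ∀ r s → 2 ∣ s → 4 < s → EvenBound r s ((s ∸ 2) / 2)
even-case r s (divides q refl) 4<s = from-half q 4<s
  where
  from-half : ∀ q → 4 < q * 2 → EvenBound r (q * 2) ((q * 2 ∸ 2) / 2)
  from-half 0 ()
  from-half 1 (s≤s (s≤s ()))
  from-half 2 (s≤s (s≤s (s≤s (s≤s ()))))
  from-half (suc (suc (suc u))) _ = subst (EvenBound r (6 + u * 2)) (sym (m*n/n≡m (2 + u) 2)) (even-bound r u)

odd-case : ∀ r s → ¬ (2 ∣ s) → 5 < s → OddBound r s ((s ∸ 2) / 2)
odd-case r s odd 5<s with even-or-odd s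
... | inj₁ (q , s≡2q) = ⊥-elim (odd (divides q s≡2q))
... | inj₂ (q , refl) = from-half q 5<s
  where
  from-half : ∀ q → 5 < 1 + q * 2 → OddBound r (1 + q * 2) ((1 + q * 2 ∸ 2) / 2)
  from-half 0 (s≤s ())
  from-half 1 (s≤s (s≤s (s≤s ())))
  from-half 2 (s≤s (s≤s (s≤s (s≤s (s≤s ())))))
  from-half (suc (suc (suc u))) _ = subst (OddBound r (7 + u * 2)) (sym (half-of-odd (2 + u))) (odd-bound r u)

K3-formula : ∀ i → 1 ≤ i → K 3 i ≡ 2 * i + 2
K3-formula (suc i) _ = K3-closed i

Kdbl3-Θ : ∀ r → IsΘ (Kdbl r 3) (λ i → i ^ 2)
Kdbl3-Θ r = 1 , 6 + 2 * kdbl₂ r , 1 , bounds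
  where
  bounds : ∀ i → 1 ≤ i → i ^ 2 ≤ 1 * Kdbl r 3 i × Kdbl r 3 i ≤ (6 + 2 * kdbl₂ r) * i ^ 2
  bounds (suc i) _ =
      subst₂ _≤_ (cong (suc i *_) (sym (*-identityʳ (suc i)))) (sym (*-identityˡ _)) (Kdbl3-lower r i)
    , subst (Kdbl r 3 (suc i) ≤_) (cong (λ z → (6 + 2 * kdbl₂ r) * (suc i * z)) (sym (*-identityʳ (suc i))))
            (≤-trans (m≤m+n _ 5) (Kdbl3-upper r i))

K4-Θ : IsΘ (K 4) (λ i → 2 ^ i)
K4-Θ = 1 , 10 , 1 , bounds
  where
  bounds : ∀ i → 1 ≤ i → 2 ^ i ≤ 1 * K 4 i × K 4 i ≤ 10 * 2 ^ i
  bounds (suc i) _ = subst (2 ^ suc i ≤_) (sym (*-identityˡ _)) (K4-lower i)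
                   , ≤-trans (K4-upper i) (≤-reflexive (*-assoc 10 2 (2 ^ i)))

Kdbl4-Θ : ∀ r → IsΘ (Kdbl r 4) (λ i → 2 ^ i)
Kdbl4-Θ r = 1 , kdbl4-const r , 1 , bounds
  where
  bounds : ∀ i → 1 ≤ i → 2 ^ i ≤ 1 * Kdbl r 4 i × Kdbl r 4 i ≤ kdbl4-const r * 2 ^ i
  bounds (suc i) _ = subst (2 ^ suc i ≤_) (sym (*-identityˡ _)) (Kdbl4-lower r i) , Kdbl4-upper r i

lemma4p5 : ∀ r → 2 ≤ r →
    (∀ i → 1 ≤ i → K 3 i ≡ 2 * i + 2)
  × IsΘ (Kdbl r 3) (λ i → i ^ 2)
  × IsΘ (K 4) (λ i → 2 ^ i)
  × IsΘ (Kdbl r 4) (λ i → 2 ^ i)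
  × (∃[ c ] Eventually (λ i → K 5 i ≤ 2 ^ i * (i + c) !))
  × (∃[ c ] Eventually (λ i → Kdbl r 5 i ≤ 2 ^ i * (i + c) !))
  × (∀ s → 2 ∣ s → 4 < s →
       ∃[ c ] Eventually (λ i →
         K s i ≤ 2 ^ ((i + c) C ((s ∸ 2) / 2))
         × Kdbl r s i ≤ 2 ^ ((i + c) C ((s ∸ 2) / 2))))
  × (∀ s → ¬ (2 ∣ s) → 5 < s →
       ∃[ c ] Eventually (λ i →
         MulExpLe (K s i) ((i + c) C ((s ∸ 2) / 2))
                  ((2 * (i + 1)) ^ ((i + c) C ((s ∸ 2) / 2)))
         × MulExpLe (Kdbl r s i) ((i + c) C ((s ∸ 2) / 2))
                  ((2 * (i + 1)) ^ ((i + c) C ((s ∸ 2) / 2)))))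
lemma4p5 r _ =
    K3-formula
  , Kdbl3-Θ r
  , K4-Θ
  , Kdbl4-Θ r
  , below-J r 5 (K 5) (K≤J r 5) factorial-bound (J5-factorial r)
  , below-J r 5 (Kdbl r 5) (Kdbl≤J r 5) factorial-bound (J5-factorial r)
  , even-case r
  , odd-case r
  where
  factorial-bound : ℕ → ℕ → ℕ
  factorial-bound c i = 2 ^ i * (i + c) !
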